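{- If $\mathcal{C}$ is a properly-splitted hypergraph, then $\psi(\mathcal{C})=\operatorname{conn_h}(\operatorname{Ind}(\mathcal{C}))+2$.
   Context: A hypergraph $\mathcal{C}$ on a finite vertex set $V$ is a family of pairwise incomparable subsets of $V$ (edges), each of cardinality at least $2$; isolated vertices allowed. $\operatorname{Ind}(\mathcal{C})$ is the simplicial complex on $V$ of subsets containing no edge. For an edge $F$: $\mathcal{C}-F$ has vertex set $V$ and edge set $\mathcal{C}\setminus\{F\}$; $N_{\mathcal{C}}(F)=\bigcup\{E\setminus F: E\in\mathcal{C},|E\setminus F|=1\}$; $\mathcal{C}:F$ is the hypergraph on $V\setminus(F\cup N_{\mathcal{C}}(F))$ whose edges are the inclusion-minimal sets among $\{E\setminus F:E\in\mathcal{C}-F\}$ of size at least $2$ (those meeting $N_{\mathcal{C}}(F)$ discarded). $\psi(\mathcal{C})\in\mathbb{Z}_{\ge0}\cup\{\infty\}$: $\psi=0$ if $V=\emptyset$; $\psi=\infty$ if $V\ne\emptyset$ and $\mathcal{C}=\emptyset$; otherwise $\psi(\mathcal{C})=\max_{F\in\mathcal{C}}\min\{\psi(\mathcal{C}-F),\psi(\mathcal{C}:F)+|F|-1\}$. $\operatorname{conn_h}(\Delta)$ is the largest integer $k$ with $\tilde H_i(\Delta;\mathbb{Z})=0$ for all $-1\le i\le k$ ($\infty$ if all vanish; $\operatorname{conn_h}(\{\emptyset\})=-2$). A hypergraph $\mathcal{C}$ is properly-splitted if either $\mathcal{C}=\emptyset$ (no edges), or $\mathcal{C}$ has an edge $F$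 with $\operatorname{conn_h}(\operatorname{Ind}(\mathcal{C}:F))\ge\operatorname{conn_h}(\operatorname{Ind}(\mathcal{C}))-|F|+1$ such that both $\mathcal{C}-F$ and $\mathcal{C}:F$ are properly-splitted (recursive definition). -}

module Defs where

open import Data.Bool using (Bool; true; false; if_then_else_; not; _∧_)
import Data.Bool as Bool
open import Data.Nat as ℕ using (ℕ; zero; suc; _∸_; _<_; _≤?_; _<ᵇ_)
open import Data.Integer as ℤ using (ℤ; 0ℤ; -_)
open import Data.Fin as Fin using (Fin; toℕ)
open import Data.Fin.Subset using (Subset; _⊆_; _∩_; _∪_; _─_; ∁; ∣_∣; ⁅_⁆; ⊥)
open import Data.Fin.Subset.Properties using (_⊆?_)
open import Data.Vec using (lookup; replicate)
open import Data.Vec.Properties using (≡-dec)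
open import Data.List using (List; []; _∷_; filter; map; foldr; allFin; length; deduplicate)
open import Data.List.Relation.Unary.All using (All)
open import Data.List.Relation.Unary.AllPairs using (AllPairs)
open import Data.List.Membership.Propositional using (_∈_)
open import Data.Product using (_×_; Σ; ∃)
open import Relation.Nullary using (¬_; ¬?; does)
open import Relation.Nullary.Decidable using (⌊_⌋)
open import Relation.Binary.PropositionalEquality using (_≡_; _≢_)
open import Relation.Binary using (DecidableEquality)

data ℕ∞ : Set where
  fin : ℕ → ℕ∞
  ∞   : ℕ∞

min∞ : ℕ∞ → ℕ∞ → ℕ∞
min∞ (fin a) (fin b) = fin (ℕ._⊓_ a b)
min∞ (fin a) ∞       = fin a
min∞ ∞       y       = y

max∞ : ℕ∞ → ℕ∞ → ℕ∞
max∞ (fin a) (fin b) = fin (ℕ._⊔_ a b)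
max∞ (fin a) ∞       = ∞
max∞ ∞       y       = ∞

_+∞_ : ℕ∞ → ℕ → ℕ∞
fin a +∞ k = fin (a ℕ.+ k)
∞     +∞ k = ∞

-- Hypergraphs with vertex set V ⊆ Fin n (the ambient Fin n is only a
-- container; the vertex set is V).

record Hypergraph (n : ℕ) : Set where
  constructor hypergraph
  field
    V     : Subset n
    edges : List (Subset n)
open Hypergraph public

Incomparable : ∀ {n} → Subset n → Subset n → Set
Incomparable A B = ¬ (A ⊆ B) × ¬ (B ⊆ A)

IsHypergraph : ∀ {n} → Hypergraph n → Set
IsHypergraph C =
  All (λ E → E ⊆ V C) (edges C) ×
  All (λ E → 2 ℕ.≤ ∣ E ∣) (edges C) ×
  AllPairs Incomparable (edges C)

_≟ₛ_ : ∀ {n} → DecidableEquality (Subset n)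
_≟ₛ_ = ≡-dec Bool._≟_

_-ₕ_ : ∀ {n} → Hypergraph n → Subset n → Hypergraph n
C -ₕ F = hypergraph (V C) (filter (λ E → ¬? (E ≟ₛ F)) (edges C))

Nbhd : ∀ {n} → Hypergraph n → Subset n → Subset n
Nbhd {n} C F =
  foldr _∪_ ⊥ (filter (λ X → ∣ X ∣ ℕ.≟ 1) (map (λ E → E ─ F) (edges C)))

_∶ₕ_ : ∀ {n} → Hypergraph n → Subset n → Hypergraph n
C ∶ₕ F = hypergraph (V C ─ (F ∪ N)) (deduplicate _≟ₛ_ minimal)
  where
    N = Nbhd C F
    disjointN : ∀ X → Bool
    disjointN X = ⌊ (X ∩ N) ≟ₛ ⊥ ⌋
    cands : List _
    cands = filter (λ X → ⌊ 2 ≤? ∣ X ∣ ⌋ Bool.≟ true)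
              (filter (λ X → disjointN X Bool.≟ true)
                (map (λ E → E ─ F) (edges (C -ₕ F))))
    strictlyBelow : _ → _ → Bool
    strictlyBelow Y X = ⌊ Y ⊆? X ⌋ ∧ not ⌊ Y ≟ₛ X ⌋
    isMin : _ → Bool
    isMin X = not (foldr (λ Y b → Bool._∨_ (strictlyBelow Y X) b) false cands)
    minimal : List _
    minimal = filter (λ X → isMin X Bool.≟ true) cands

-- Defined with fuel = number of edges; each recursive call
-- (C - F and C : F) has strictly fewer edges, so this fuel suffices and
-- the 'zero' fuel clause is never reached for a nonempty edge list.

maxList : List ℕ∞ → ℕ∞
maxList = foldr max∞ (fin 0)

ψ′ : ∀ {n} → ℕ → Hypergraph n → ℕ∞
ψ′ fuel C with ⌊ V C ≟ₛ ⊥ ⌋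
ψ′ fuel    C | true = fin 0
ψ′ fuel    C | false with edges C
ψ′ fuel    C | false | [] = ∞
ψ′ zero    C | false | _ ∷ _ = fin 0
ψ′ (suc f) C | false | Es@(_ ∷ _) =
  maxList (map (λ F → min∞ (ψ′ f (C -ₕ F)) (ψ′ f (C ∶ₕ F) +∞ (∣ F ∣ ∸ 1))) Es)

ψ : ∀ {n} → Hypergraph n → ℕ∞
ψ C = ψ′ (length (edges C)) C

-- Simplicial complexes on Fin n given by a face predicate, and reduced
-- simplicial homology with ℤ coefficients.
-- A chain is a function Subset n → ℤ; a k-chain (k = i+1 = number of
-- vertices, i = dimension, i ≥ -1) is supported on faces with k vertices.

Complex : ℕ → Set₁
Complex n = Subset n → Set

Ind : ∀ {n} → Hypergraph n → Complex n
Ind C σ = σ ⊆ V C × All (λ E → ¬ (E ⊆ σ)) (edges C)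

Chain : ℕ → Set
Chain n = Subset n → ℤ

SupportedOn : ∀ {n} → Complex n → ℕ → Chain n → Set
SupportedOn Δ k c = ∀ σ → ¬ (Δ σ × ∣ σ ∣ ≡ k) → c σ ≡ 0ℤ

sgn : ℕ → ℤ → ℤ
sgn zero    x = x
sgn (suc m) x = - sgn m x

below : ∀ {n} → Subset n → Fin n → ℕ
below {n} τ v = length (filter (λ u → Bool._≟_ (lookup τ u ∧ (toℕ u <ᵇ toℕ v)) true) (allFin n))

-- simplicial boundary w.r.t. the vertex order of Fin n:
-- ∂σ = Σ_j (-1)^j (σ ∖ {v_j}), v_0 < v_1 < …; coefficient of τ in ∂c:
∂ : ∀ {n} → Chain n → Chain n
∂ {n} c τ = foldr ℤ._+_ 0ℤ
  (map (λ v → if lookup τ v then 0ℤ else sgn (below τ v) (c (τ ∪ ⁅ v ⁆))) (allFin n))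

-- H̃_{k-1}(Δ; ℤ) = 0   (k = 0 is H̃_{-1}, with augmentation ∂{v} = ∅)
HVanish : ∀ {n} → Complex n → ℕ → Set
HVanish Δ k = ∀ (c : Chain _) → SupportedOn Δ k c → (∀ τ → ∂ c τ ≡ 0ℤ) →
  Σ (Chain _) λ d → SupportedOn Δ (suc k) d × (∀ σ → ∂ d σ ≡ c σ)

-- conn_h(Δ) + 2 ≥ j   ⇔   H̃_i(Δ) = 0 for all -1 ≤ i ≤ j - 2
ConnAtLeast : ∀ {n} → Complex n → ℕ → Set
ConnAtLeast Δ j = ∀ k → k < j → HVanish Δ k

-- ConnH Δ x  :⇔  conn_h(Δ) + 2 = x   (x ∈ ℕ ∪ {∞}; note conn_h ≥ -2)
ConnH : ∀ {n} → Complex n → ℕ∞ → Set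
ConnH Δ (fin j) = ConnAtLeast Δ j × ¬ HVanish Δ j
ConnH Δ ∞       = ∀ k → HVanish Δ k

-- properly-splitted
-- condition conn_h(Ind(C:F)) ≥ conn_h(Ind C) - |F| + 1, written as:
-- for all j, conn_h(Ind C)+2 ≥ j implies conn_h(Ind(C:F))+2 ≥ j+1-|F|
-- (truncation at 0 harmless since conn_h+2 ≥ 0 always).

data ProperlySplitted {n : ℕ} : Hypergraph n → Set where
  noEdges : ∀ {C} → edges C ≡ [] → ProperlySplitted C
  split   : ∀ {C} F → F ∈ edges C →
            (∀ j → ConnAtLeast (Ind C) j → ConnAtLeast (Ind (C ∶ₕ F)) (suc j ∸ ∣ F ∣)) →
            ProperlySplitted (C -ₕ F) → ProperlySplitted (C ∶ₕ F) →
            ProperlySplitted C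

module Submission where

-- Removing an edge F from C only adds faces containing F: the faces of Ind(C − F) without F are those
-- of Ind C, and those with F are the F ∪ τ for τ ∈ Ind(C : F). On chains, joining with F identifies the
-- relative part with Ind(C : F) shifted by |F|, and diagram chasing gives
-- conn Ind C ≥ min(conn Ind(C − F), conn Ind(C : F) + |F| − 1); induction on the recursion of ψ then
-- shows ψ(C) ≤ conn_h(Ind C) + 2, the base cases being {∅} (no vertices) and a full simplex (no edges).
-- Conversely, if F splits C properly and H̃ also vanished in degree ψ(C) − 1, the same chase and the
-- induction hypotheses for C − F and C : F would give min(ψ(C − F), ψ(C : F) + |F| − 1) > ψ(C),
-- although ψ(C) is the maximum of such terms.

open import Defs

import Algebra.Properties.CommutativeMonoid.Sum as CommutativeMonoidSum
open import Data.Bool as Bool using (Bool; true; false; if_then_else_; _∧_; _∨_; not; T)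
import Data.Bool.Properties as Boolₚ
open import Data.Empty using (⊥-elim)
open import Data.Fin using (Fin; zero; suc; toℕ)
import Data.Fin.Properties as Finₚ
open import Data.Fin.Subset using (Subset; ⁅_⁆; _∪_; _∩_; _─_; ∣_∣; ⊥; _⊆_)
open import Data.Fin.Subset.Properties
  using (_⊆?_; ⊆-antisym; p⊆q⇒∣p∣≤∣q∣; p⊂q⇒∣p∣<∣q∣; ∣⁅x⁆∣≡1; x∈p⇒∣p-x∣<∣p∣; ∣⊥∣≡0; nonempty?; Empty-unique)
open import Data.Integer using (ℤ; 0ℤ; 1ℤ; -_; _+_; +0; +[1+_]; -[1+_])
import Data.Integer.Properties as ℤₚ
open import Data.List using (List; []; _∷_; foldr; map; filter; length; deduplicate; tabulate; allFin)
open import Data.List.Membership.Propositional using (_∈_)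
open import Data.List.Membership.Propositional.Properties
  using (∈-filter⁺; ∈-filter⁻; ∈-map⁺; ∈-map⁻; ∈-deduplicate⁺; ∈-deduplicate⁻)
import Data.List.Properties as Listₚ
open import Data.List.Relation.Unary.All as All using (All; []; _∷_)
import Data.List.Relation.Unary.All.Properties as AllP
open import Data.List.Relation.Unary.AllPairs using (AllPairs; []; _∷_)
import Data.List.Relation.Unary.AllPairs.Properties as AllPairsP
open import Data.List.Relation.Unary.Any as Any using (here; there)
import Data.List.Relation.Unary.Unique.DecPropositional.Properties as Unique
open import Data.Nat as ℕ using (ℕ; zero; suc; _∸_; _≤_; _<_; z≤n; s≤s; _≤?_)
import Data.Nat.Properties as ℕₚ
open import Data.Nat.Tactic.RingSolver using (solve-∀)
open import Data.Product using (_×_; _,_; proj₁; proj₂; ∃)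
open import Data.Sum using (_⊎_; inj₁; inj₂)
open import Data.Vec using ([]; _∷_; lookup)
open import Data.Vec.Properties
  using (lookup-zipWith; lookup-replicate; tabulate∘lookup; tabulate-cong; []=⇒lookup; lookup⇒[]=)
open import Function using (id; _∘_)
open import Relation.Binary.PropositionalEquality
open import Relation.Nullary using (¬_; Dec; yes; no; does; ¬?)
open import Relation.Nullary.Decidable using (⌊_⌋; _→-dec_; dec-true; dec-false; isYes≗does)

open CommutativeMonoidSum ℤₚ.+-0-commutativeMonoid
  using (sum; sum-cong-≗; sum-replicate-zero; ∑-distrib-+; ∑-comm)
module ℕSum = CommutativeMonoidSum ℕₚ.+-0-commutativeMonoid

sum-zero : ∀ {n} {f : Fin n → ℤ} → (∀ i → f i ≡ 0ℤ) → sum f ≡ 0ℤ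
sum-zero {n} f≡0 = trans (sum-cong-≗ f≡0) (sum-replicate-zero n)

sum-neg : ∀ {n} (f : Fin n → ℤ) → sum (λ i → - f i) ≡ - sum f
sum-neg {zero}  f = refl
sum-neg {suc n} f =
  trans (cong (- f zero +_) (sum-neg (f ∘ suc))) (sym (ℤₚ.neg-distrib-+ (f zero) (sum (f ∘ suc))))

sum-single : ∀ {n} (f : Fin n → ℤ) (v : Fin n) → (∀ i → i ≢ v → f i ≡ 0ℤ) → sum f ≡ f v
sum-single {suc n} f zero    f≡0 =
  trans (cong (f zero +_) (sum-zero (λ i → f≡0 (suc i) λ ()))) (ℤₚ.+-identityʳ _)
sum-single {suc n} f (suc v) f≡0 =
  trans (cong (_+ sum (f ∘ suc)) (f≡0 zero λ ())) (trans (ℤₚ.+-identityˡ _)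
        (sum-single (f ∘ suc) v (λ i i≢v → f≡0 (suc i) (i≢v ∘ Finₚ.suc-injective))))

foldr-map-allFin≡sum : ∀ {n} (f : Fin n → ℤ) → foldr _+_ 0ℤ (map f (allFin n)) ≡ sum f
foldr-map-allFin≡sum f = trans (cong (foldr _+_ 0ℤ) (Listₚ.map-tabulate id f)) (go f)
  where
  go : ∀ {n} (f : Fin n → ℤ) → foldr _+_ 0ℤ (tabulate f) ≡ sum f
  go {zero}  f = refl
  go {suc n} f = cong (f zero +_) (go (f ∘ suc))

x≡-x⇒x≡0 : ∀ x → x ≡ - x → x ≡ 0ℤ
x≡-x⇒x≡0 +0       _ = refl
x≡-x⇒x≡0 +[1+ n ] ()
x≡-x⇒x≡0 -[1+ n ] ()

sum-antisymmetric≡0 : ∀ {n} (h : Fin n → Fin n → ℤ) → (∀ i j → h i j ≡ - h j i) →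
  sum (λ i → sum (h i)) ≡ 0ℤ
sum-antisymmetric≡0 h h-anti = x≡-x⇒x≡0 _ (begin
    sum (λ i → sum (h i))           ≡⟨ ∑-comm h ⟩
    sum (λ j → sum (λ i → h i j))   ≡⟨ sum-cong-≗ (λ j → sum-cong-≗ (λ i → h-anti i j)) ⟩
    sum (λ j → sum (λ i → - h j i)) ≡⟨ sum-cong-≗ (λ j → sum-neg (h j)) ⟩
    sum (λ j → - sum (h j))         ≡⟨ sum-neg (λ j → sum (h j)) ⟩
    - sum (λ i → sum (h i))         ∎)
  where open ≡-Reasoning

sgn-+ : ∀ m k x → sgn (m ℕ.+ k) x ≡ sgn m (sgn k x)
sgn-+ zero    k x = refl
sgn-+ (suc m) k x = cong -_ (sgn-+ m k x)

sgn-neg : ∀ m x → sgn m (- x) ≡ - sgn m x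
sgn-neg zero    x = refl
sgn-neg (suc m) x = cong -_ (sgn-neg m x)

sgn-distrib-+ : ∀ m x y → sgn m (x + y) ≡ sgn m x + sgn m y
sgn-distrib-+ zero    x y = refl
sgn-distrib-+ (suc m) x y = trans (cong -_ (sgn-distrib-+ m x y)) (ℤₚ.neg-distrib-+ (sgn m x) (sgn m y))

sgn-0 : ∀ m → sgn m 0ℤ ≡ 0ℤ
sgn-0 zero    = refl
sgn-0 (suc m) = cong -_ (sgn-0 m)

sgn-involutive : ∀ m x → sgn m (sgn m x) ≡ x
sgn-involutive zero    x = refl
sgn-involutive (suc m) x = begin
  - sgn m (- sgn m x) ≡⟨ cong -_ (sgn-neg m (sgn m x)) ⟩
  - - sgn m (sgn m x) ≡⟨ ℤₚ.neg-involutive _ ⟩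
  sgn m (sgn m x)     ≡⟨ sgn-involutive m x ⟩
  x                   ∎
  where open ≡-Reasoning

sgn≡0⇒≡0 : ∀ m x → sgn m x ≡ 0ℤ → x ≡ 0ℤ
sgn≡0⇒≡0 m x eq = trans (sym (sgn-involutive m x)) (trans (cong (sgn m) eq) (sgn-0 m))

sgn-double : ∀ m x → sgn (m ℕ.+ m) x ≡ x
sgn-double m x = trans (sgn-+ m m x) (sgn-involutive m x)

sgn-swap : ∀ a x {p q} → (p ≡ 1 × q ≡ 0) ⊎ (p ≡ 0 × q ≡ 1) → sgn (a ℕ.+ p) x ≡ - sgn (a ℕ.+ q) x
sgn-swap a x (inj₁ (refl , refl)) = begin
  sgn (a ℕ.+ 1) x   ≡⟨ sgn-+ a 1 x ⟩
  sgn a (- x)       ≡⟨ sgn-neg a x ⟩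
  - sgn a x         ≡⟨ cong (λ k → - sgn k x) (ℕₚ.+-identityʳ a) ⟨
  - sgn (a ℕ.+ 0) x ∎
  where open ≡-Reasoning
sgn-swap a x (inj₂ (refl , refl)) = begin
  sgn (a ℕ.+ 0) x     ≡⟨ cong (λ k → sgn k x) (ℕₚ.+-identityʳ a) ⟩
  sgn a x             ≡⟨ ℤₚ.neg-involutive _ ⟨
  - - sgn a x         ≡⟨ cong -_ (trans (sgn-+ a 1 x) (sgn-neg a x)) ⟨
  - sgn (a ℕ.+ 1) x   ∎
  where open ≡-Reasoning

sgn-transposition : ∀ a b x {p q} → (p ≡ 1 × q ≡ 0) ⊎ (p ≡ 0 × q ≡ 1) →
  sgn (a ℕ.+ p) (sgn (b ℕ.+ q) x) ≡ - sgn b (sgn a x)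
sgn-transposition a b x pq =
  trans (sym (sgn-+ (a ℕ.+ _) (b ℕ.+ _) x)) (trans (cong (λ k → sgn k x) (exponent pq)) (cong -_ (sgn-+ b a x)))
  where
  exponent : ∀ {p q} → (p ≡ 1 × q ≡ 0) ⊎ (p ≡ 0 × q ≡ 1) → (a ℕ.+ p) ℕ.+ (b ℕ.+ q) ≡ suc (b ℕ.+ a)
  exponent (inj₁ (refl , refl)) = p≡1 a b
    where p≡1 : ∀ a b → (a ℕ.+ 1) ℕ.+ (b ℕ.+ 0) ≡ suc (b ℕ.+ a)
          p≡1 = solve-∀
  exponent (inj₂ (refl , refl)) = q≡1 a b
    where q≡1 : ∀ a b → (a ℕ.+ 0) ℕ.+ (b ℕ.+ 1) ≡ suc (b ℕ.+ a)
          q≡1 = solve-∀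

sgn-shuffle : ∀ a b c x → sgn (a ℕ.+ b) (sgn (c ℕ.+ a) x) ≡ sgn c (sgn b x)
sgn-shuffle a b c x = begin
  sgn (a ℕ.+ b) (sgn (c ℕ.+ a) x) ≡⟨ sgn-+ (a ℕ.+ b) (c ℕ.+ a) x ⟨
  sgn ((a ℕ.+ b) ℕ.+ (c ℕ.+ a)) x ≡⟨ cong (λ k → sgn k x) (exponent a b c) ⟩
  sgn ((c ℕ.+ b) ℕ.+ (a ℕ.+ a)) x ≡⟨ sgn-+ (c ℕ.+ b) (a ℕ.+ a) x ⟩
  sgn (c ℕ.+ b) (sgn (a ℕ.+ a) x) ≡⟨ cong (sgn (c ℕ.+ b)) (sgn-double a x) ⟩
  sgn (c ℕ.+ b) x                 ≡⟨ sgn-+ c b x ⟩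
  sgn c (sgn b x)                 ∎
  where
  open ≡-Reasoning
  exponent : ∀ a b c → (a ℕ.+ b) ℕ.+ (c ℕ.+ a) ≡ (c ℕ.+ b) ℕ.+ (a ℕ.+ a)
  exponent = solve-∀

sum-sgn : ∀ {n} m (f : Fin n → ℤ) → sum (λ i → sgn m (f i)) ≡ sgn m (sum f)
sum-sgn zero    f = refl
sum-sgn (suc m) f = trans (sum-neg (λ i → sgn m (f i))) (cong -_ (sum-sgn m f))

infix 4 _⊆ₗ_

_⊆ₗ_ : ∀ {n} → Subset n → Subset n → Set
A ⊆ₗ B = ∀ u → lookup A u ≡ true → lookup B u ≡ true

Disjoint : ∀ {n} → Subset n → Subset n → Set
Disjoint A B = ∀ u → (lookup A u ∧ lookup B u) ≡ false

true≢false : true ≢ false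
true≢false ()

subset-ext : ∀ {n} {a b : Subset n} → (∀ u → lookup a u ≡ lookup b u) → a ≡ b
subset-ext {a = a} {b} eq =
  trans (sym (tabulate∘lookup a)) (trans (tabulate-cong eq) (tabulate∘lookup b))

⊆⇒⊆ₗ : ∀ {n} {A B : Subset n} → A ⊆ B → A ⊆ₗ B
⊆⇒⊆ₗ {A = A} A⊆B u u∈A = []=⇒lookup (A⊆B (lookup⇒[]= u A u∈A))

⊆ₗ⇒⊆ : ∀ {n} {A B : Subset n} → A ⊆ₗ B → A ⊆ B
⊆ₗ⇒⊆ {B = B} A⊆B {u} u∈A = lookup⇒[]= u B (A⊆B u ([]=⇒lookup u∈A))

⊆ₗ-trans : ∀ {n} (A B C : Subset n) → A ⊆ₗ B → B ⊆ₗ C → A ⊆ₗ C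
⊆ₗ-trans A B C A⊆B B⊆C u u∈A = B⊆C u (A⊆B u u∈A)

⊆ₗ-antisym : ∀ {n} (A B : Subset n) → A ⊆ₗ B → B ⊆ₗ A → A ≡ B
⊆ₗ-antisym A B A⊆B B⊆A = ⊆-antisym (⊆ₗ⇒⊆ {A = A} {B = B} A⊆B) (⊆ₗ⇒⊆ {A = B} {B = A} B⊆A)

_⊆ₗ?_ : ∀ {n} (A B : Subset n) → Dec (A ⊆ₗ B)
A ⊆ₗ? B = Finₚ.all? λ u → (lookup A u Bool.≟ true) →-dec (lookup B u Bool.≟ true)

disjoint? : ∀ {n} (A B : Subset n) → Dec (Disjoint A B)
disjoint? A B = Finₚ.all? λ u → (lookup A u ∧ lookup B u) Bool.≟ false

⊈ₗ⇒witness : ∀ {n} {A B : Subset n} → ¬ A ⊆ₗ B → ∃ λ u → lookup A u ≡ true × lookup B u ≡ false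
⊈ₗ⇒witness {n} {A} {B} A⊈B with Finₚ.¬∀⟶∃¬ n (λ u → lookup A u ≡ true → lookup B u ≡ true)
                                   (λ u → (lookup A u Bool.≟ true) →-dec (lookup B u Bool.≟ true)) A⊈B
... | u , ¬u∈B with lookup A u in u∈A | lookup B u in u∉B
...   | true  | false = u , u∈A , u∉B
...   | true  | true  = ⊥-elim (¬u∈B λ _ → refl)
...   | false | _     = ⊥-elim (¬u∈B λ ())

lookup-∪ : ∀ {n} (a b : Subset n) u → lookup (a ∪ b) u ≡ (lookup a u ∨ lookup b u)
lookup-∪ a b u = lookup-zipWith _∨_ u a b

lookup-∩ : ∀ {n} (a b : Subset n) u → lookup (a ∩ b) u ≡ (lookup a u ∧ lookup b u)
lookup-∩ a b u = lookup-zipWith _∧_ u a b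

lookup-─ : ∀ {n} (a b : Subset n) u → lookup (a ─ b) u ≡ (lookup a u ∧ not (lookup b u))
lookup-─ (x ∷ a) (true  ∷ b) zero    = sym (Boolₚ.∧-zeroʳ x)
lookup-─ (x ∷ a) (false ∷ b) zero    = sym (Boolₚ.∧-identityʳ x)
lookup-─ (x ∷ a) (y     ∷ b) (suc u) = lookup-─ a b u

∈─⁻ : ∀ {n} (A B : Subset n) u → lookup (A ─ B) u ≡ true → lookup A u ≡ true × lookup B u ≡ false
∈─⁻ A B u u∈A─B with lookup A u | lookup B u | trans (sym (lookup-─ A B u)) u∈A─B
... | true | false | _ = refl , refl

∈─⁺ : ∀ {n} (A B : Subset n) u → lookup A u ≡ true → lookup B u ≡ false → lookup (A ─ B) u ≡ true
∈─⁺ A B u u∈A u∉B = trans (lookup-─ A B u) (cong₂ (λ a b → a ∧ not b) u∈A u∉B)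

lookup-⊥ : ∀ {n} (u : Fin n) → lookup ⊥ u ≡ false
lookup-⊥ u = lookup-replicate u false

lookup-⁅⁆-self : ∀ {n} (v : Fin n) → lookup ⁅ v ⁆ v ≡ true
lookup-⁅⁆-self zero    = refl
lookup-⁅⁆-self (suc v) = lookup-⁅⁆-self v

lookup-⁅⁆-other : ∀ {n} (v u : Fin n) → u ≢ v → lookup ⁅ v ⁆ u ≡ false
lookup-⁅⁆-other zero    zero    u≢v = ⊥-elim (u≢v refl)
lookup-⁅⁆-other zero    (suc u) u≢v = lookup-⊥ u
lookup-⁅⁆-other (suc v) zero    u≢v = refl
lookup-⁅⁆-other (suc v) (suc u) u≢v = lookup-⁅⁆-other v u (u≢v ∘ cong suc)

lookup-∪⁅⁆-self : ∀ {n} (τ : Subset n) v → lookup (τ ∪ ⁅ v ⁆) v ≡ true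
lookup-∪⁅⁆-self τ v =
  trans (lookup-∪ τ ⁅ v ⁆ v) (trans (cong (lookup τ v ∨_) (lookup-⁅⁆-self v)) (Boolₚ.∨-zeroʳ _))

lookup-∪⁅⁆-other : ∀ {n} (τ : Subset n) v u → u ≢ v → lookup (τ ∪ ⁅ v ⁆) u ≡ lookup τ u
lookup-∪⁅⁆-other τ v u u≢v =
  trans (lookup-∪ τ ⁅ v ⁆ u) (trans (cong (lookup τ u ∨_) (lookup-⁅⁆-other v u u≢v)) (Boolₚ.∨-identityʳ _))

p⊆ₗp∪q : ∀ {n} (A B : Subset n) → A ⊆ₗ A ∪ B
p⊆ₗp∪q A B u u∈A = trans (lookup-∪ A B u) (cong (_∨ lookup B u) u∈A)

q⊆ₗp∪q : ∀ {n} (A B : Subset n) → B ⊆ₗ A ∪ B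
q⊆ₗp∪q A B u u∈B = trans (lookup-∪ A B u) (trans (cong (lookup A u ∨_) u∈B) (Boolₚ.∨-zeroʳ _))

disjoint-sym : ∀ {n} (A B : Subset n) → Disjoint A B → Disjoint B A
disjoint-sym A B A#B u = trans (Boolₚ.∧-comm (lookup B u) (lookup A u)) (A#B u)

─-disjoint : ∀ {n} (A B : Subset n) → Disjoint (A ─ B) B
─-disjoint A B u rewrite lookup-─ A B u with lookup A u | lookup B u
... | true  | true  = refl
... | true  | false = refl
... | false | _     = refl

∪-─-cancel : ∀ {n} (F σ : Subset n) → F ⊆ₗ σ → F ∪ (σ ─ F) ≡ σ
∪-─-cancel F σ F⊆σ = subset-ext λ u → go u
  where
  go : ∀ u → lookup (F ∪ (σ ─ F)) u ≡ lookup σ u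
  go u rewrite lookup-∪ F (σ ─ F) u | lookup-─ σ F u with lookup F u in u∈F
  ... | true  = sym (F⊆σ u u∈F)
  ... | false = Boolₚ.∧-identityʳ (lookup σ u)

∪-─-cancelˡ : ∀ {n} (F τ : Subset n) → Disjoint τ F → (F ∪ τ) ─ F ≡ τ
∪-─-cancelˡ F τ τ#F = subset-ext λ u → go u
  where
  go : ∀ u → lookup ((F ∪ τ) ─ F) u ≡ lookup τ u
  go u rewrite lookup-─ (F ∪ τ) F u | lookup-∪ F τ u with lookup F u in u∈F | lookup τ u in u∈τ
  ... | true  | true  = ⊥-elim (true≢false (trans (sym (cong₂ _∧_ u∈τ u∈F)) (τ#F u)))
  ... | true  | false = refl
  ... | false | b     = Boolₚ.∧-identityʳ b

∪-swap⁅⁆ : ∀ {n} (τ : Subset n) v w → (τ ∪ ⁅ v ⁆) ∪ ⁅ w ⁆ ≡ (τ ∪ ⁅ w ⁆) ∪ ⁅ v ⁆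
∪-swap⁅⁆ τ v w = subset-ext λ u → begin
    lookup ((τ ∪ ⁅ v ⁆) ∪ ⁅ w ⁆) u
      ≡⟨ trans (lookup-∪ (τ ∪ ⁅ v ⁆) ⁅ w ⁆ u) (cong (_∨ _) (lookup-∪ τ ⁅ v ⁆ u)) ⟩
    (lookup τ u ∨ lookup ⁅ v ⁆ u) ∨ lookup ⁅ w ⁆ u
      ≡⟨ ∨-swap (lookup τ u) (lookup ⁅ v ⁆ u) (lookup ⁅ w ⁆ u) ⟩
    (lookup τ u ∨ lookup ⁅ w ⁆ u) ∨ lookup ⁅ v ⁆ u
      ≡⟨ trans (lookup-∪ (τ ∪ ⁅ w ⁆) ⁅ v ⁆ u) (cong (_∨ _) (lookup-∪ τ ⁅ w ⁆ u)) ⟨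
    lookup ((τ ∪ ⁅ w ⁆) ∪ ⁅ v ⁆) u ∎
  where
  open ≡-Reasoning
  ∨-swap : ∀ a b c → ((a ∨ b) ∨ c) ≡ ((a ∨ c) ∨ b)
  ∨-swap a b c = trans (Boolₚ.∨-assoc a b c)
    (trans (cong (a ∨_) (Boolₚ.∨-comm b c)) (sym (Boolₚ.∨-assoc a c b)))

remove-insert : ∀ {n} (ρ : Subset n) v → lookup ρ v ≡ true → (ρ ─ ⁅ v ⁆) ∪ ⁅ v ⁆ ≡ ρ
remove-insert ρ v v∈ρ = subset-ext λ u → go u
  where
  go : ∀ u → lookup ((ρ ─ ⁅ v ⁆) ∪ ⁅ v ⁆) u ≡ lookup ρ u
  go u with u Finₚ.≟ v
  ... | yes refl = trans (lookup-∪⁅⁆-self (ρ ─ ⁅ v ⁆) u) (sym v∈ρ)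
  ... | no u≢v   = trans (lookup-∪⁅⁆-other (ρ ─ ⁅ v ⁆) v u u≢v)
    (trans (lookup-─ ρ ⁅ v ⁆ u) (trans (cong (λ b → lookup ρ u ∧ not b) (lookup-⁅⁆-other v u u≢v)) (Boolₚ.∧-identityʳ _)))

insert-remove : ∀ {n} (σ : Subset n) w → lookup σ w ≡ false → (σ ∪ ⁅ w ⁆) ─ ⁅ w ⁆ ≡ σ
insert-remove σ w w∉σ = subset-ext λ u → go u
  where
  go : ∀ u → lookup ((σ ∪ ⁅ w ⁆) ─ ⁅ w ⁆) u ≡ lookup σ u
  go u rewrite lookup-─ (σ ∪ ⁅ w ⁆) ⁅ w ⁆ u with u Finₚ.≟ w
  ... | yes refl rewrite lookup-⁅⁆-self u = trans (Boolₚ.∧-zeroʳ _) (sym w∉σ)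
  ... | no u≢w rewrite lookup-⁅⁆-other w u u≢w | lookup-∪⁅⁆-other σ w u u≢w = Boolₚ.∧-identityʳ _

lookup-remove-self : ∀ {n} (ρ : Subset n) v → lookup (ρ ─ ⁅ v ⁆) v ≡ false
lookup-remove-self ρ v rewrite lookup-─ ρ ⁅ v ⁆ v | lookup-⁅⁆-self v = Boolₚ.∧-zeroʳ (lookup ρ v)

weight : ∀ {n} → Subset n → (Fin n → ℕ) → ℕ
weight τ w = ℕSum.sum (λ u → if lookup τ u then w u else 0)

isBelow : ∀ {n} → Fin n → Fin n → ℕ
isBelow u v = if toℕ u ℕ.<ᵇ toℕ v then 1 else 0

∣∣≡weight : ∀ {n} (σ : Subset n) → ∣ σ ∣ ≡ weight σ (λ _ → 1)
∣∣≡weight []          = refl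
∣∣≡weight (true  ∷ σ) = cong suc (∣∣≡weight σ)
∣∣≡weight (false ∷ σ) = ∣∣≡weight σ

below≡weight : ∀ {n} (τ : Subset n) v → below τ v ≡ weight τ (λ u → isBelow u v)
below≡weight {n} τ v = trans (count (λ u → lookup τ u ∧ (toℕ u ℕ.<ᵇ toℕ v)) id)
  (ℕSum.sum-cong-≗ λ u → ∧-indicator (lookup τ u) (toℕ u ℕ.<ᵇ toℕ v))
  where
  count : ∀ {m} (b : Fin n → Bool) (g : Fin m → Fin n) →
    length (filter (λ u → b u Bool.≟ true) (tabulate g)) ≡ ℕSum.sum (λ u → if b (g u) then 1 else 0)
  count {zero}  b g = refl
  count {suc m} b g with b (g zero)
  ... | true  = cong suc (count b (g ∘ suc))
  ... | false = count b (g ∘ suc)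
  ∧-indicator : ∀ a p → (if a ∧ p then 1 else 0) ≡ (if a then (if p then 1 else 0) else 0)
  ∧-indicator true  p = refl
  ∧-indicator false p = refl

weight-⊥ : ∀ {n} w → weight (⊥ {n}) w ≡ 0
weight-⊥ {n} w =
  trans (ℕSum.sum-cong-≗ λ u → cong (λ z → if z then w u else 0) (lookup-⊥ u)) (ℕSum.sum-replicate-zero n)

weight-⁅⁆ : ∀ {n} (v : Fin n) w → weight ⁅ v ⁆ w ≡ w v
weight-⁅⁆ zero    w = trans (cong (w zero ℕ.+_) (weight-⊥ (w ∘ suc))) (ℕₚ.+-identityʳ _)
weight-⁅⁆ (suc v) w = weight-⁅⁆ v (w ∘ suc)

weight-∪ : ∀ {n} (a b : Subset n) w → Disjoint a b → weight (a ∪ b) w ≡ weight a w ℕ.+ weight b w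
weight-∪ a b w a#b =
  trans (ℕSum.sum-cong-≗ pointwise)
        (ℕSum.∑-distrib-+ (λ u → if lookup a u then w u else 0) (λ u → if lookup b u then w u else 0))
  where
  pointwise : ∀ u → (if lookup (a ∪ b) u then w u else 0) ≡
                    (if lookup a u then w u else 0) ℕ.+ (if lookup b u then w u else 0)
  pointwise u rewrite lookup-∪ a b u with lookup a u | lookup b u | a#b u
  ... | true  | false | _ = sym (ℕₚ.+-identityʳ _)
  ... | false | _     | _ = refl

disjoint-⁅⁆ : ∀ {n} (τ : Subset n) v → lookup τ v ≡ false → Disjoint τ ⁅ v ⁆
disjoint-⁅⁆ τ v v∉τ u with u Finₚ.≟ v
... | yes refl = cong (_∧ _) v∉τ
... | no u≢v   = trans (cong (lookup τ u ∧_) (lookup-⁅⁆-other v u u≢v)) (Boolₚ.∧-zeroʳ _)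

weight-insert : ∀ {n} (τ : Subset n) v w → lookup τ v ≡ false → weight (τ ∪ ⁅ v ⁆) w ≡ weight τ w ℕ.+ w v
weight-insert τ v w v∉τ = trans (weight-∪ τ ⁅ v ⁆ w (disjoint-⁅⁆ τ v v∉τ)) (cong (_ ℕ.+_) (weight-⁅⁆ v w))

below-insert : ∀ {n} (τ : Subset n) v w → lookup τ v ≡ false → below (τ ∪ ⁅ v ⁆) w ≡ below τ w ℕ.+ isBelow v w
below-insert τ v w v∉τ = begin
  below (τ ∪ ⁅ v ⁆) w                               ≡⟨ below≡weight (τ ∪ ⁅ v ⁆) w ⟩
  weight (τ ∪ ⁅ v ⁆) (λ u → isBelow u w)            ≡⟨ weight-insert τ v (λ u → isBelow u w) v∉τ ⟩
  weight τ (λ u → isBelow u w) ℕ.+ isBelow v w      ≡⟨ cong (ℕ._+ isBelow v w) (below≡weight τ w) ⟨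
  below τ w ℕ.+ isBelow v w                          ∎
  where open ≡-Reasoning

∣insert∣ : ∀ {n} (τ : Subset n) v → lookup τ v ≡ false → ∣ τ ∪ ⁅ v ⁆ ∣ ≡ suc ∣ τ ∣
∣insert∣ τ v v∉τ = begin
  ∣ τ ∪ ⁅ v ⁆ ∣                  ≡⟨ ∣∣≡weight (τ ∪ ⁅ v ⁆) ⟩
  weight (τ ∪ ⁅ v ⁆) (λ _ → 1)   ≡⟨ weight-insert τ v (λ _ → 1) v∉τ ⟩
  weight τ (λ _ → 1) ℕ.+ 1       ≡⟨ ℕₚ.+-comm _ 1 ⟩
  suc (weight τ (λ _ → 1))       ≡⟨ cong suc (∣∣≡weight τ) ⟨
  suc ∣ τ ∣                      ∎
  where open ≡-Reasoning

∣∪∣ : ∀ {n} (A B : Subset n) → Disjoint A B → ∣ A ∪ B ∣ ≡ ∣ A ∣ ℕ.+ ∣ B ∣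
∣∪∣ A B A#B = trans (∣∣≡weight (A ∪ B))
  (trans (weight-∪ A B (λ _ → 1) A#B) (sym (cong₂ ℕ._+_ (∣∣≡weight A) (∣∣≡weight B))))

∣∣≡∣F∣+∣─F∣ : ∀ {n} (F σ : Subset n) → F ⊆ₗ σ → ∣ σ ∣ ≡ ∣ F ∣ ℕ.+ ∣ σ ─ F ∣
∣∣≡∣F∣+∣─F∣ F σ F⊆σ =
  trans (cong ∣_∣ (sym (∪-─-cancel F σ F⊆σ))) (∣∪∣ F (σ ─ F) (disjoint-sym (σ ─ F) F (─-disjoint σ F)))

below-split : ∀ {n} (F σ : Subset n) v → F ⊆ₗ σ → below σ v ≡ below F v ℕ.+ below (σ ─ F) v
below-split F σ v F⊆σ = begin
  below σ v                                 ≡⟨ below≡weight σ v ⟩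
  weight σ [·<v]                            ≡⟨ cong (λ ρ → weight ρ [·<v]) (∪-─-cancel F σ F⊆σ) ⟨
  weight (F ∪ (σ ─ F)) [·<v]                ≡⟨ weight-∪ F (σ ─ F) [·<v] (disjoint-sym (σ ─ F) F (─-disjoint σ F)) ⟩
  weight F [·<v] ℕ.+ weight (σ ─ F) [·<v]   ≡⟨ cong₂ ℕ._+_ (below≡weight F v) (below≡weight (σ ─ F) v) ⟨
  below F v ℕ.+ below (σ ─ F) v             ∎
  where
  open ≡-Reasoning
  [·<v] : Fin _ → ℕ
  [·<v] u = isBelow u v

isBelow-irrefl : ∀ {n} (v : Fin n) → isBelow v v ≡ 0
isBelow-irrefl v with toℕ v ℕ.<ᵇ toℕ v in v<v
... | false = refl
... | true  = ⊥-elim (ℕₚ.<-irrefl refl (ℕₚ.<ᵇ⇒< (toℕ v) (toℕ v) (subst T (sym v<v) _)))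

isBelow-antisym : ∀ {n} {v w : Fin n} → v ≢ w →
  (isBelow v w ≡ 1 × isBelow w v ≡ 0) ⊎ (isBelow v w ≡ 0 × isBelow w v ≡ 1)
isBelow-antisym {v = v} {w} v≢w with toℕ v ℕ.<ᵇ toℕ w in v<w | toℕ w ℕ.<ᵇ toℕ v in w<v
... | true  | false = inj₁ (refl , refl)
... | false | true  = inj₂ (refl , refl)
... | true  | true  = ⊥-elim (ℕₚ.<-asym (<ᵇ-sound {toℕ v} v<w) (<ᵇ-sound {toℕ w} w<v))
  where
  <ᵇ-sound : ∀ {a b} → (a ℕ.<ᵇ b) ≡ true → a < b
  <ᵇ-sound {a} {b} eq = ℕₚ.<ᵇ⇒< a b (subst T (sym eq) _)
... | false | false = ⊥-elim (v≢w (Finₚ.toℕ-injective (ℕₚ.≤-antisym (≮ {toℕ v} w<v) (≮ {toℕ w} v<w))))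
  where
  ≮ : ∀ {a b} → (b ℕ.<ᵇ a) ≡ false → a ≤ b
  ≮ {a} {b} eq = ℕₚ.≮⇒≥ λ b<a → subst T eq (ℕₚ.<⇒<ᵇ b<a)

-- The boundary operator

∂-summand : ∀ {n} → Chain n → Subset n → Fin n → ℤ
∂-summand c τ v = if lookup τ v then 0ℤ else sgn (below τ v) (c (τ ∪ ⁅ v ⁆))

∂≡sum : ∀ {n} (c : Chain n) τ → ∂ c τ ≡ sum (∂-summand c τ)
∂≡sum c τ = foldr-map-allFin≡sum (∂-summand c τ)

∂-summand-inside : ∀ {n} (c : Chain n) τ v → lookup τ v ≡ true → ∂-summand c τ v ≡ 0ℤ
∂-summand-inside c τ v v∈τ = cong (λ b → if b then 0ℤ else sgn (below τ v) (c (τ ∪ ⁅ v ⁆))) v∈τ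

∂-summand-outside : ∀ {n} (c : Chain n) τ v → lookup τ v ≡ false →
  ∂-summand c τ v ≡ sgn (below τ v) (c (τ ∪ ⁅ v ⁆))
∂-summand-outside c τ v v∉τ = cong (λ b → if b then 0ℤ else sgn (below τ v) (c (τ ∪ ⁅ v ⁆))) v∉τ

∂-cong-cofaces : ∀ {n} (c d : Chain n) τ → (∀ v → lookup τ v ≡ false → c (τ ∪ ⁅ v ⁆) ≡ d (τ ∪ ⁅ v ⁆)) →
  ∂ c τ ≡ ∂ d τ
∂-cong-cofaces c d τ c≡d = trans (∂≡sum c τ) (trans (sum-cong-≗ summand≡) (sym (∂≡sum d τ)))
  where
  summand≡ : ∀ v → ∂-summand c τ v ≡ ∂-summand d τ v
  summand≡ v with lookup τ v in v∉τ
  ... | true  = refl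
  ... | false = cong (sgn (below τ v)) (c≡d v v∉τ)

∂-vanishes : ∀ {n} (c : Chain n) τ → (∀ v → lookup τ v ≡ false → c (τ ∪ ⁅ v ⁆) ≡ 0ℤ) → ∂ c τ ≡ 0ℤ
∂-vanishes c τ c≡0 = trans (∂-cong-cofaces c (λ _ → 0ℤ) τ c≡0) (trans (∂≡sum _ τ) (sum-zero summand≡0))
  where
  summand≡0 : ∀ v → ∂-summand (λ _ → 0ℤ) τ v ≡ 0ℤ
  summand≡0 v with lookup τ v
  ... | true  = refl
  ... | false = sgn-0 (below τ v)

∂-supported : ∀ {n} (Δ : Complex n) → (∀ τ v → lookup τ v ≡ false → Δ (τ ∪ ⁅ v ⁆) → Δ τ) →
  ∀ k c → SupportedOn Δ (suc k) c → SupportedOn Δ k (∂ c)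
∂-supported Δ Δ-down-closed k c c-supp τ τ∉Δₖ = ∂-vanishes c τ λ v v∉τ → c-supp (τ ∪ ⁅ v ⁆) λ where
  (τ∪v∈Δ , ∣τ∪v∣≡k+1) → τ∉Δₖ (Δ-down-closed τ v v∉τ τ∪v∈Δ , ℕₚ.suc-injective (trans (sym (∣insert∣ τ v v∉τ)) ∣τ∪v∣≡k+1))

∂-+ : ∀ {n} (c d : Chain n) τ → ∂ (λ σ → c σ + d σ) τ ≡ ∂ c τ + ∂ d τ
∂-+ c d τ = begin
  ∂ (λ σ → c σ + d σ) τ                     ≡⟨ ∂≡sum (λ σ → c σ + d σ) τ ⟩
  sum (∂-summand (λ σ → c σ + d σ) τ)       ≡⟨ sum-cong-≗ summand-+ ⟩
  sum (λ v → ∂-summand c τ v + ∂-summand d τ v) ≡⟨ ∑-distrib-+ (∂-summand c τ) (∂-summand d τ) ⟩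
  sum (∂-summand c τ) + sum (∂-summand d τ) ≡⟨ cong₂ _+_ (∂≡sum c τ) (∂≡sum d τ) ⟨
  ∂ c τ + ∂ d τ                             ∎
  where
  open ≡-Reasoning
  summand-+ : ∀ v → ∂-summand (λ σ → c σ + d σ) τ v ≡ ∂-summand c τ v + ∂-summand d τ v
  summand-+ v with lookup τ v
  ... | true  = refl
  ... | false = sgn-distrib-+ (below τ v) (c (τ ∪ ⁅ v ⁆)) (d (τ ∪ ⁅ v ⁆))

∂-neg : ∀ {n} (c : Chain n) τ → ∂ (λ σ → - c σ) τ ≡ - ∂ c τ
∂-neg c τ = begin
  ∂ (λ σ → - c σ) τ                ≡⟨ ∂≡sum (λ σ → - c σ) τ ⟩
  sum (∂-summand (λ σ → - c σ) τ)  ≡⟨ sum-cong-≗ summand-neg ⟩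
  sum (λ v → - ∂-summand c τ v)    ≡⟨ sum-neg (∂-summand c τ) ⟩
  - sum (∂-summand c τ)            ≡⟨ cong -_ (∂≡sum c τ) ⟨
  - ∂ c τ                          ∎
  where
  open ≡-Reasoning
  summand-neg : ∀ v → ∂-summand (λ σ → - c σ) τ v ≡ - ∂-summand c τ v
  summand-neg v with lookup τ v
  ... | true  = refl
  ... | false = sgn-neg (below τ v) (c (τ ∪ ⁅ v ⁆))

-- The (v, w) term of ∂ (∂ c) at τ; it carries the coefficient of τ ∪ {v, w}.
∂∂-summand : ∀ {n} → Chain n → Subset n → Fin n → Fin n → ℤ
∂∂-summand c τ v w = if lookup τ v then 0ℤ else sgn (below τ v) (∂-summand c (τ ∪ ⁅ v ⁆) w)

∂∂-summand-degenerate : ∀ {n} (c : Chain n) τ v w → lookup τ v ≡ true ⊎ lookup τ w ≡ true ⊎ v ≡ w →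
  ∂∂-summand c τ v w ≡ 0ℤ
∂∂-summand-degenerate c τ v w (inj₁ v∈τ) rewrite v∈τ = refl
∂∂-summand-degenerate c τ v w (inj₂ (inj₁ w∈τ)) with lookup τ v
... | true  = refl
... | false rewrite lookup-∪ τ ⁅ v ⁆ w | w∈τ = sgn-0 (below τ v)
∂∂-summand-degenerate c τ v .v (inj₂ (inj₂ refl)) with lookup τ v
... | true  = refl
... | false rewrite lookup-∪⁅⁆-self τ v = sgn-0 (below τ v)

∂∂-summand-value : ∀ {n} (c : Chain n) τ v w → lookup τ v ≡ false → lookup τ w ≡ false → v ≢ w →
  ∂∂-summand c τ v w ≡ sgn ((below τ v ℕ.+ below τ w) ℕ.+ isBelow v w) (c ((τ ∪ ⁅ v ⁆) ∪ ⁅ w ⁆))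
∂∂-summand-value c τ v w v∉τ w∉τ v≢w
  rewrite v∉τ | lookup-∪⁅⁆-other τ v w (v≢w ∘ sym) | w∉τ | below-insert τ v w v∉τ
        | ℕₚ.+-assoc (below τ v) (below τ w) (isBelow v w) = sym (sgn-+ (below τ v) _ _)

∂∂-summand-antisym : ∀ {n} (c : Chain n) τ v w → ∂∂-summand c τ v w ≡ - ∂∂-summand c τ w v
∂∂-summand-antisym c τ v w with lookup τ v Bool.≟ true | lookup τ w Bool.≟ true | v Finₚ.≟ w
... | yes v∈τ | _       | _ = trans (∂∂-summand-degenerate c τ v w (inj₁ v∈τ))
                                (cong -_ (sym (∂∂-summand-degenerate c τ w v (inj₂ (inj₁ v∈τ)))))
... | no _    | yes w∈τ | _ = trans (∂∂-summand-degenerate c τ v w (inj₂ (inj₁ w∈τ)))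
                                (cong -_ (sym (∂∂-summand-degenerate c τ w v (inj₁ w∈τ))))
... | no _    | no _    | yes refl = trans (∂∂-summand-degenerate c τ v v (inj₂ (inj₂ refl)))
                                (cong -_ (sym (∂∂-summand-degenerate c τ v v (inj₂ (inj₂ refl)))))
... | no v∉τ  | no w∉τ  | no v≢w = begin
  ∂∂-summand c τ v w                    ≡⟨ ∂∂-summand-value c τ v w (Boolₚ.¬-not v∉τ) (Boolₚ.¬-not w∉τ) v≢w ⟩
  sgn ((bv ℕ.+ bw) ℕ.+ isBelow v w) X   ≡⟨ sgn-swap (bv ℕ.+ bw) X (isBelow-antisym v≢w) ⟩
  - sgn ((bv ℕ.+ bw) ℕ.+ isBelow w v) X
    ≡⟨ cong₂ (λ k σ → - sgn (k ℕ.+ isBelow w v) (c σ)) (ℕₚ.+-comm bv bw) (∪-swap⁅⁆ τ v w) ⟩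
  - sgn ((bw ℕ.+ bv) ℕ.+ isBelow w v) (c ((τ ∪ ⁅ w ⁆) ∪ ⁅ v ⁆))
    ≡⟨ cong -_ (∂∂-summand-value c τ w v (Boolₚ.¬-not w∉τ) (Boolₚ.¬-not v∉τ) (v≢w ∘ sym)) ⟨
  - ∂∂-summand c τ w v                  ∎
  where
  open ≡-Reasoning
  bv bw : ℕ
  bv = below τ v
  bw = below τ w
  X : ℤ
  X = c ((τ ∪ ⁅ v ⁆) ∪ ⁅ w ⁆)

∂∘∂≡0 : ∀ {n} (c : Chain n) τ → ∂ (∂ c) τ ≡ 0ℤ
∂∘∂≡0 {n} c τ = trans (∂≡sum (∂ c) τ)
  (trans (sum-cong-≗ expand) (sum-antisymmetric≡0 (∂∂-summand c τ) (∂∂-summand-antisym c τ)))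
  where
  expand : ∀ v → ∂-summand (∂ c) τ v ≡ sum (∂∂-summand c τ v)
  expand v = trans (cong (λ z → if lookup τ v then 0ℤ else sgn (below τ v) z) (∂≡sum c (τ ∪ ⁅ v ⁆)))
                   (if-sum (lookup τ v))
    where
    if-sum : ∀ b → (if b then 0ℤ else sgn (below τ v) (sum (∂-summand c (τ ∪ ⁅ v ⁆)))) ≡
                   sum (λ w → if b then 0ℤ else sgn (below τ v) (∂-summand c (τ ∪ ⁅ v ⁆) w))
    if-sum true  = sym (sum-zero {n} λ _ → refl)
    if-sum false = sym (sum-sgn (below τ v) (∂-summand c (τ ∪ ⁅ v ⁆)))

∂-minus-boundary : ∀ {n} (c g : Chain n) τ → ∂ (λ σ → c σ + - ∂ g σ) τ ≡ ∂ c τ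
∂-minus-boundary c g τ = begin
  ∂ (λ σ → c σ + - ∂ g σ) τ   ≡⟨ ∂-+ c (λ σ → - ∂ g σ) τ ⟩
  ∂ c τ + ∂ (λ σ → - ∂ g σ) τ ≡⟨ cong (∂ c τ +_) (∂-neg (∂ g) τ) ⟩
  ∂ c τ + - ∂ (∂ g) τ         ≡⟨ cong (λ z → ∂ c τ + - z) (∂∘∂≡0 g τ) ⟩
  ∂ c τ + 0ℤ                  ≡⟨ ℤₚ.+-identityʳ (∂ c τ) ⟩
  ∂ c τ                       ∎
  where open ≡-Reasoning

-- Cones are acyclic

_⋆_ : ∀ {n} → Fin n → Chain n → Chain n
(v ⋆ c) ρ = if lookup ρ v then sgn (below ρ v) (c (ρ ─ ⁅ v ⁆)) else 0ℤ

⋆-apex : ∀ {n} v (c : Chain n) ρ → lookup ρ v ≡ true → (v ⋆ c) ρ ≡ sgn (below ρ v) (c (ρ ─ ⁅ v ⁆))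
⋆-apex v c ρ v∈ρ = cong (λ b → if b then sgn (below ρ v) (c (ρ ─ ⁅ v ⁆)) else 0ℤ) v∈ρ

below-insert-self : ∀ {n} (ρ : Subset n) v → lookup ρ v ≡ false → below (ρ ∪ ⁅ v ⁆) v ≡ below ρ v
below-insert-self ρ v v∉ρ =
  trans (below-insert ρ v v v∉ρ) (trans (cong (below ρ v ℕ.+_) (isBelow-irrefl v)) (ℕₚ.+-identityʳ _))

∂-⋆-off-apex : ∀ {n} v (c : Chain n) σ → lookup σ v ≡ false → ∂ (v ⋆ c) σ ≡ c σ
∂-⋆-off-apex v c σ v∉σ =
  trans (∂≡sum (v ⋆ c) σ) (trans (sum-single (∂-summand (v ⋆ c) σ) v summand≡0) summand-at-apex)
  where
  summand≡0 : ∀ w → w ≢ v → ∂-summand (v ⋆ c) σ w ≡ 0ℤ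
  summand≡0 w w≢v with lookup σ w
  ... | true  = refl
  ... | false rewrite lookup-∪⁅⁆-other σ w v (w≢v ∘ sym) | v∉σ = sgn-0 (below σ w)
  summand-at-apex : ∂-summand (v ⋆ c) σ v ≡ c σ
  summand-at-apex rewrite v∉σ = begin
    sgn (below σ v) ((v ⋆ c) (σ ∪ ⁅ v ⁆))
      ≡⟨ cong (sgn (below σ v)) (⋆-apex v c (σ ∪ ⁅ v ⁆) (lookup-∪⁅⁆-self σ v)) ⟩
    sgn (below σ v) (sgn (below (σ ∪ ⁅ v ⁆) v) (c ((σ ∪ ⁅ v ⁆) ─ ⁅ v ⁆)))
      ≡⟨ cong₂ (λ k τ → sgn (below σ v) (sgn k (c τ))) (below-insert-self σ v v∉σ) (insert-remove σ v v∉σ) ⟩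
    sgn (below σ v) (sgn (below σ v) (c σ))
      ≡⟨ sgn-involutive (below σ v) (c σ) ⟩
    c σ ∎
    where open ≡-Reasoning

⋆-cofacet : ∀ {n} v (c : Chain n) ρ w → lookup ρ v ≡ false → lookup ρ w ≡ false → w ≢ v →
  (v ⋆ c) ((ρ ∪ ⁅ v ⁆) ∪ ⁅ w ⁆) ≡ sgn (below ρ v ℕ.+ isBelow w v) (c (ρ ∪ ⁅ w ⁆))
⋆-cofacet v c ρ w v∉ρ w∉ρ w≢v = begin
  (v ⋆ c) σ′                                              ≡⟨ ⋆-apex v c σ′ v∈σ′ ⟩
  sgn (below σ′ v) (c (σ′ ─ ⁅ v ⁆))                       ≡⟨ cong₂ (λ k τ → sgn k (c τ)) below≡ σ′─v≡ ⟩
  sgn (below ρ v ℕ.+ isBelow w v) (c (ρ ∪ ⁅ w ⁆))         ∎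
  where
  open ≡-Reasoning
  σ′ : Subset _
  σ′ = (ρ ∪ ⁅ v ⁆) ∪ ⁅ w ⁆
  v∈σ′ : lookup σ′ v ≡ true
  v∈σ′ = trans (lookup-∪⁅⁆-other (ρ ∪ ⁅ v ⁆) w v (w≢v ∘ sym)) (lookup-∪⁅⁆-self ρ v)
  w∉ρ∪v : lookup (ρ ∪ ⁅ v ⁆) w ≡ false
  w∉ρ∪v = trans (lookup-∪⁅⁆-other ρ v w w≢v) w∉ρ
  below≡ : below σ′ v ≡ below ρ v ℕ.+ isBelow w v
  below≡ = trans (below-insert (ρ ∪ ⁅ v ⁆) w v w∉ρ∪v) (cong (ℕ._+ isBelow w v) (below-insert-self ρ v v∉ρ))
  σ′─v≡ : σ′ ─ ⁅ v ⁆ ≡ ρ ∪ ⁅ w ⁆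
  σ′─v≡ = trans (cong (_─ ⁅ v ⁆) (∪-swap⁅⁆ ρ v w))
    (insert-remove (ρ ∪ ⁅ w ⁆) v (trans (lookup-∪⁅⁆-other ρ w v (w≢v ∘ sym)) v∉ρ))

∂-⋆-summand : ∀ {n} v (c : Chain n) ρ → lookup ρ v ≡ false → ∀ w →
  ∂-summand (v ⋆ c) (ρ ∪ ⁅ v ⁆) w ≡
  - sgn (below ρ v) (∂-summand c ρ w) + (if does (w Finₚ.≟ v) then c (ρ ∪ ⁅ v ⁆) else 0ℤ)
∂-⋆-summand v c ρ v∉ρ w with w Finₚ.≟ v
... | yes refl rewrite lookup-∪⁅⁆-self ρ w | v∉ρ =
  sym (trans (cong (λ z → - z + c (ρ ∪ ⁅ w ⁆)) (sgn-involutive (below ρ w) _)) (ℤₚ.+-inverseˡ (c (ρ ∪ ⁅ w ⁆))))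
... | no w≢v rewrite lookup-∪⁅⁆-other ρ v w w≢v with lookup ρ w in w∈ρ
...   | true  = sym (cong (λ z → - z + 0ℤ) (sgn-0 (below ρ v)))
...   | false = begin
  sgn (below (ρ ∪ ⁅ v ⁆) w) ((v ⋆ c) ((ρ ∪ ⁅ v ⁆) ∪ ⁅ w ⁆))
    ≡⟨ cong₂ sgn (below-insert ρ v w v∉ρ) (⋆-cofacet v c ρ w v∉ρ w∈ρ w≢v) ⟩
  sgn (below ρ w ℕ.+ isBelow v w) (sgn (below ρ v ℕ.+ isBelow w v) (c (ρ ∪ ⁅ w ⁆)))
    ≡⟨ sgn-transposition (below ρ w) (below ρ v) _ (isBelow-antisym (w≢v ∘ sym)) ⟩
  - sgn (below ρ v) (sgn (below ρ w) (c (ρ ∪ ⁅ w ⁆)))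
    ≡⟨ ℤₚ.+-identityʳ _ ⟨
  - sgn (below ρ v) (sgn (below ρ w) (c (ρ ∪ ⁅ w ⁆))) + 0ℤ ∎
  where open ≡-Reasoning

∂-⋆-on-apex : ∀ {n} v (c : Chain n) ρ → lookup ρ v ≡ false →
  ∂ (v ⋆ c) (ρ ∪ ⁅ v ⁆) ≡ - sgn (below ρ v) (∂ c ρ) + c (ρ ∪ ⁅ v ⁆)
∂-⋆-on-apex v c ρ v∉ρ = begin
  ∂ (v ⋆ c) (ρ ∪ ⁅ v ⁆)                          ≡⟨ ∂≡sum (v ⋆ c) (ρ ∪ ⁅ v ⁆) ⟩
  sum (∂-summand (v ⋆ c) (ρ ∪ ⁅ v ⁆))            ≡⟨ sum-cong-≗ (∂-⋆-summand v c ρ v∉ρ) ⟩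
  sum (λ w → - sgn b (∂-summand c ρ w) + δ w)    ≡⟨ ∑-distrib-+ (λ w → - sgn b (∂-summand c ρ w)) δ ⟩
  sum (λ w → - sgn b (∂-summand c ρ w)) + sum δ  ≡⟨ cong₂ _+_ negated-boundary (sum-single δ v δ-off-apex) ⟩
  - sgn b (∂ c ρ) + δ v                          ≡⟨ cong (- sgn b (∂ c ρ) +_) δ-at-apex ⟩
  - sgn b (∂ c ρ) + c (ρ ∪ ⁅ v ⁆)                ∎
  where
  open ≡-Reasoning
  b : ℕ
  b = below ρ v
  δ : Fin _ → ℤ
  δ w = if does (w Finₚ.≟ v) then c (ρ ∪ ⁅ v ⁆) else 0ℤ
  δ-off-apex : ∀ w → w ≢ v → δ w ≡ 0ℤ
  δ-off-apex w w≢v with w Finₚ.≟ v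
  ... | yes w≡v = ⊥-elim (w≢v w≡v)
  ... | no _    = refl
  δ-at-apex : δ v ≡ c (ρ ∪ ⁅ v ⁆)
  δ-at-apex with v Finₚ.≟ v
  ... | yes _   = refl
  ... | no v≢v  = ⊥-elim (v≢v refl)
  negated-boundary : sum (λ w → - sgn b (∂-summand c ρ w)) ≡ - sgn b (∂ c ρ)
  negated-boundary = trans (sum-neg (λ w → sgn b (∂-summand c ρ w)))
    (cong -_ (trans (sum-sgn b (∂-summand c ρ)) (cong (sgn b) (sym (∂≡sum c ρ)))))

∂-⋆-cycle : ∀ {n} v (c : Chain n) → (∀ τ → ∂ c τ ≡ 0ℤ) → ∀ σ → ∂ (v ⋆ c) σ ≡ c σ
∂-⋆-cycle v c c-cycle σ with lookup σ v Bool.≟ true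
... | no v∉σ  = ∂-⋆-off-apex v c σ (Boolₚ.¬-not v∉σ)
... | yes v∈σ = subst (λ σ → ∂ (v ⋆ c) σ ≡ c σ) (remove-insert σ v v∈σ) (begin
  ∂ (v ⋆ c) (ρ ∪ ⁅ v ⁆)                              ≡⟨ ∂-⋆-on-apex v c ρ (lookup-remove-self σ v) ⟩
  - sgn (below ρ v) (∂ c ρ) + c (ρ ∪ ⁅ v ⁆)          ≡⟨ cong (λ z → - sgn (below ρ v) z + c (ρ ∪ ⁅ v ⁆)) (c-cycle ρ) ⟩
  - sgn (below ρ v) 0ℤ + c (ρ ∪ ⁅ v ⁆)               ≡⟨ cong (λ z → - z + c (ρ ∪ ⁅ v ⁆)) (sgn-0 (below ρ v)) ⟩
  0ℤ + c (ρ ∪ ⁅ v ⁆)                                 ≡⟨ ℤₚ.+-identityˡ _ ⟩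
  c (ρ ∪ ⁅ v ⁆)                                      ∎)
  where
  open ≡-Reasoning
  ρ : Subset _
  ρ = σ ─ ⁅ v ⁆

cone-acyclic : ∀ {n} (Δ : Complex n) v → (∀ τ → Δ τ → Δ (τ ∪ ⁅ v ⁆)) → ∀ k → HVanish Δ k
cone-acyclic Δ v Δ-cone k c c-supported c-cycle = v ⋆ c , ⋆-supported , ∂-⋆-cycle v c c-cycle
  where
  ⋆-supported : SupportedOn Δ (suc k) (v ⋆ c)
  ⋆-supported ρ ρ∉Δₖ₊₁ with lookup ρ v in v∈ρ
  ... | false = refl
  ... | true  = trans (cong (sgn (below ρ v)) (c-supported (ρ ─ ⁅ v ⁆) ρ─v∉Δₖ)) (sgn-0 (below ρ v))
    where
    ρ─v∉Δₖ : ¬ (Δ (ρ ─ ⁅ v ⁆) × ∣ ρ ─ ⁅ v ⁆ ∣ ≡ k)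
    ρ─v∉Δₖ (ρ─v∈Δ , ∣ρ─v∣≡k) = ρ∉Δₖ₊₁
      ( subst Δ (remove-insert ρ v v∈ρ) (Δ-cone _ ρ─v∈Δ)
      , trans (cong ∣_∣ (sym (remove-insert ρ v v∈ρ)))
              (trans (∣insert∣ (ρ ─ ⁅ v ⁆) v (lookup-remove-self ρ v)) (cong suc ∣ρ─v∣≡k)))

-- Joining chains with a fixed simplex F

insert-─ : ∀ {n} (σ F : Subset n) v → lookup F v ≡ false → (σ ∪ ⁅ v ⁆) ─ F ≡ (σ ─ F) ∪ ⁅ v ⁆
insert-─ σ F v v∉F = subset-ext λ u → go u
  where
  go : ∀ u → lookup ((σ ∪ ⁅ v ⁆) ─ F) u ≡ lookup ((σ ─ F) ∪ ⁅ v ⁆) u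
  go u rewrite lookup-─ (σ ∪ ⁅ v ⁆) F u with u Finₚ.≟ v
  ... | yes refl rewrite lookup-∪⁅⁆-self σ u | lookup-∪⁅⁆-self (σ ─ F) u | v∉F = refl
  ... | no u≢v rewrite lookup-∪⁅⁆-other σ v u u≢v | lookup-∪⁅⁆-other (σ ─ F) v u u≢v = sym (lookup-─ σ F u)

module Join {n} (F : Subset n) where

  -- The sign of the shuffle listing F before τ.
  inversions : Subset n → ℕ
  inversions τ = weight τ (below F)

  join : Chain n → Chain n
  join f σ = if does (F ⊆ₗ? σ) then sgn (inversions (σ ─ F)) (f (σ ─ F)) else 0ℤ

  join-⊇ : ∀ f σ → F ⊆ₗ σ → join f σ ≡ sgn (inversions (σ ─ F)) (f (σ ─ F))
  join-⊇ f σ F⊆σ = cong (λ b → if b then sgn (inversions (σ ─ F)) (f (σ ─ F)) else 0ℤ) (dec-true (F ⊆ₗ? σ) F⊆σ)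

  join-⊉ : ∀ f σ → ¬ F ⊆ₗ σ → join f σ ≡ 0ℤ
  join-⊉ f σ F⊈σ = cong (λ b → if b then sgn (inversions (σ ─ F)) (f (σ ─ F)) else 0ℤ) (dec-false (F ⊆ₗ? σ) F⊈σ)

  AvoidsF : Chain n → Set
  AvoidsF f = ∀ τ u → lookup τ u ≡ true → lookup F u ≡ true → f τ ≡ 0ℤ

  ∂-join-summand-fresh : ∀ f σ → F ⊆ₗ σ → ∀ v → lookup F v ≡ false → lookup σ v ≡ false →
    ∂-summand (join f) σ v ≡ sgn (inversions (σ ─ F)) (∂-summand f (σ ─ F) v)
  ∂-join-summand-fresh f σ F⊆σ v v∉F v∉σ = begin
    ∂-summand (join f) σ v
      ≡⟨ ∂-summand-outside (join f) σ v v∉σ ⟩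
    sgn (below σ v) (join f (σ ∪ ⁅ v ⁆))
      ≡⟨ cong (sgn (below σ v)) (join-⊇ f (σ ∪ ⁅ v ⁆) (⊆ₗ-trans F σ (σ ∪ ⁅ v ⁆) F⊆σ (p⊆ₗp∪q σ ⁅ v ⁆))) ⟩
    sgn (below σ v) (sgn (inversions ((σ ∪ ⁅ v ⁆) ─ F)) (f ((σ ∪ ⁅ v ⁆) ─ F)))
      ≡⟨ cong (λ ρ → sgn (below σ v) (sgn (inversions ρ) (f ρ))) (insert-─ σ F v v∉F) ⟩
    sgn (below σ v) (sgn (inversions (τ ∪ ⁅ v ⁆)) (f (τ ∪ ⁅ v ⁆)))
      ≡⟨ cong₂ (λ a b → sgn a (sgn b (f (τ ∪ ⁅ v ⁆)))) (below-split F σ v F⊆σ) (weight-insert τ v (below F) v∉τ) ⟩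
    sgn (below F v ℕ.+ below τ v) (sgn (inversions τ ℕ.+ below F v) (f (τ ∪ ⁅ v ⁆)))
      ≡⟨ sgn-shuffle (below F v) (below τ v) (inversions τ) (f (τ ∪ ⁅ v ⁆)) ⟩
    sgn (inversions τ) (sgn (below τ v) (f (τ ∪ ⁅ v ⁆)))
      ≡⟨ cong (sgn (inversions τ)) (∂-summand-outside f τ v v∉τ) ⟨
    sgn (inversions τ) (∂-summand f τ v) ∎
    where
    open ≡-Reasoning
    τ : Subset n
    τ = σ ─ F
    v∉τ : lookup τ v ≡ false
    v∉τ = trans (lookup-─ σ F v) (cong (_∧ not (lookup F v)) v∉σ)

  ∂-join-summand : ∀ f → AvoidsF f → ∀ σ → F ⊆ₗ σ → ∀ v →
    ∂-summand (join f) σ v ≡ sgn (inversions (σ ─ F)) (∂-summand f (σ ─ F) v)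
  ∂-join-summand f f-avoids σ F⊆σ v with lookup F v Bool.≟ true | lookup σ v Bool.≟ true
  ... | yes v∈F | _ = trans (∂-summand-inside (join f) σ v (F⊆σ v v∈F))
                            (sym (trans (cong (sgn (inversions τ)) summand≡0) (sgn-0 (inversions τ))))
    where
    τ : Subset n
    τ = σ ─ F
    v∉τ : lookup τ v ≡ false
    v∉τ = trans (lookup-─ σ F v) (trans (cong (λ b → lookup σ v ∧ not b) v∈F) (Boolₚ.∧-zeroʳ _))
    summand≡0 : ∂-summand f τ v ≡ 0ℤ
    summand≡0 = trans (∂-summand-outside f τ v v∉τ)
      (trans (cong (sgn (below τ v)) (f-avoids (τ ∪ ⁅ v ⁆) v (lookup-∪⁅⁆-self τ v) v∈F)) (sgn-0 (below τ v)))
  ... | no v∉F | yes v∈σ = trans (∂-summand-inside (join f) σ v v∈σ)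
                            (sym (trans (cong (sgn (inversions τ)) (∂-summand-inside f τ v v∈τ)) (sgn-0 (inversions τ))))
    where
    τ : Subset n
    τ = σ ─ F
    v∈τ : lookup τ v ≡ true
    v∈τ = ∈─⁺ σ F v v∈σ (Boolₚ.¬-not v∉F)
  ... | no v∉F | no v∉σ = ∂-join-summand-fresh f σ F⊆σ v (Boolₚ.¬-not v∉F) (Boolₚ.¬-not v∉σ)

  ∂-join : ∀ f → AvoidsF f → ∀ σ → F ⊆ₗ σ → ∂ (join f) σ ≡ sgn (inversions (σ ─ F)) (∂ f (σ ─ F))
  ∂-join f f-avoids σ F⊆σ = begin
    ∂ (join f) σ                                          ≡⟨ ∂≡sum (join f) σ ⟩
    sum (∂-summand (join f) σ)                            ≡⟨ sum-cong-≗ (∂-join-summand f f-avoids σ F⊆σ) ⟩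
    sum (λ v → sgn (inversions (σ ─ F)) (∂-summand f (σ ─ F) v)) ≡⟨ sum-sgn (inversions (σ ─ F)) (∂-summand f (σ ─ F)) ⟩
    sgn (inversions (σ ─ F)) (sum (∂-summand f (σ ─ F)))  ≡⟨ cong (sgn (inversions (σ ─ F))) (∂≡sum f (σ ─ F)) ⟨
    sgn (inversions (σ ─ F)) (∂ f (σ ─ F))                ∎
    where open ≡-Reasoning

infix 4 _≤∞_

data _≤∞_ : ℕ∞ → ℕ∞ → Set where
  fin≤fin : ∀ {a b} → a ≤ b → fin a ≤∞ fin b
  ≤∞-top  : ∀ {x} → x ≤∞ ∞

≤∞-trans : ∀ {x y z} → x ≤∞ y → y ≤∞ z → x ≤∞ z
≤∞-trans (fin≤fin a≤b) (fin≤fin b≤c) = fin≤fin (ℕₚ.≤-trans a≤b b≤c)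
≤∞-trans _             ≤∞-top        = ≤∞-top

≤∞-max∞ˡ : ∀ x y → x ≤∞ max∞ x y
≤∞-max∞ˡ (fin a) (fin b) = fin≤fin (ℕₚ.m≤m⊔n a b)
≤∞-max∞ˡ (fin a) ∞       = ≤∞-top
≤∞-max∞ˡ ∞       y       = ≤∞-top

≤∞-max∞ʳ : ∀ x y → y ≤∞ max∞ x y
≤∞-max∞ʳ (fin a) (fin b) = fin≤fin (ℕₚ.m≤n⊔m a b)
≤∞-max∞ʳ (fin a) ∞       = ≤∞-top
≤∞-max∞ʳ ∞       y       = ≤∞-top

≤∞-maxList : ∀ {x xs} → x ∈ xs → x ≤∞ maxList xs
≤∞-maxList {x} {_ ∷ xs} (here refl) = ≤∞-max∞ˡ x (maxList xs)
≤∞-maxList {_} {y ∷ xs} (there x∈) = ≤∞-trans (≤∞-maxList x∈) (≤∞-max∞ʳ y (maxList xs))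

≤∞-max∞⁻ : ∀ {m} x y → fin m ≤∞ max∞ x y → fin m ≤∞ x ⊎ fin m ≤∞ y
≤∞-max∞⁻ (fin a) (fin b) (fin≤fin m≤a⊔b) with ℕₚ.⊔-sel a b
... | inj₁ a⊔b≡a = inj₁ (fin≤fin (subst (_ ≤_) a⊔b≡a m≤a⊔b))
... | inj₂ a⊔b≡b = inj₂ (fin≤fin (subst (_ ≤_) a⊔b≡b m≤a⊔b))
≤∞-max∞⁻ (fin a) ∞ _ = inj₂ ≤∞-top
≤∞-max∞⁻ ∞       y _ = inj₁ ≤∞-top

≤∞-maxList⁻ : ∀ {m} xs → fin (suc m) ≤∞ maxList xs → ∃ λ x → x ∈ xs × fin (suc m) ≤∞ x
≤∞-maxList⁻ []       (fin≤fin ())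
≤∞-maxList⁻ (x ∷ xs) m≤max with ≤∞-max∞⁻ x (maxList xs) m≤max
... | inj₁ m≤x = x , here refl , m≤x
... | inj₂ m≤maxList with ≤∞-maxList⁻ xs m≤maxList
...   | y , y∈xs , m≤y = y , there y∈xs , m≤y

min∞-glb : ∀ {z} x y → z ≤∞ x → z ≤∞ y → z ≤∞ min∞ x y
min∞-glb (fin a) (fin b) (fin≤fin c≤a) (fin≤fin c≤b) = fin≤fin (ℕₚ.⊓-glb c≤a c≤b)
min∞-glb (fin a) ∞       z≤x           _             = z≤x
min∞-glb ∞       y       _             z≤y           = z≤y

min∞⁻ : ∀ {m} x y → fin m ≤∞ min∞ x y → fin m ≤∞ x × fin m ≤∞ y
min∞⁻ (fin a) (fin b) (fin≤fin m≤a⊓b) = fin≤fin (ℕₚ.≤-trans m≤a⊓b (ℕₚ.m⊓n≤m a b)) , fin≤fin (ℕₚ.≤-trans m≤a⊓b (ℕₚ.m⊓n≤n a b))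
min∞⁻ (fin a) ∞       m≤a             = m≤a , ≤∞-top
min∞⁻ ∞       y       m≤y             = ≤∞-top , m≤y

+∞-shift⁺ : ∀ {m p} x → 1 ≤ p → fin (suc m ∸ p) ≤∞ x → fin m ≤∞ x +∞ (p ∸ 1)
+∞-shift⁺ {m} {suc p} (fin b) _ (fin≤fin m∸p≤b) =
  fin≤fin (subst (m ≤_) (ℕₚ.+-comm p b) (ℕₚ.≤-trans (ℕₚ.m≤n+m∸n m p) (ℕₚ.+-monoʳ-≤ p m∸p≤b)))
+∞-shift⁺ ∞ _ _ = ≤∞-top

+∞-shift⁻ : ∀ {k p} x → 1 ≤ p → p ≤ suc k → fin (suc k) ≤∞ x +∞ (p ∸ 1) → fin (suc (suc k ∸ p)) ≤∞ x
+∞-shift⁻ {k} {suc p} (fin b) _ p≤k (fin≤fin k<b+p) =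
  fin≤fin (ℕₚ.+-cancelʳ-< p (k ∸ p) b (subst (_< b ℕ.+ p) (sym (ℕₚ.m∸n+n≡m (ℕₚ.≤-pred p≤k))) k<b+p))
+∞-shift⁻ ∞ _ _ _ = ≤∞-top

ConnAtLeast∞ : ∀ {n} → Complex n → ℕ∞ → Set
ConnAtLeast∞ Δ x = ∀ k → fin (suc k) ≤∞ x → HVanish Δ k

ConnAtLeast∞-fin : ∀ {n} {Δ : Complex n} {j} → ConnAtLeast∞ Δ (fin j) → ConnAtLeast Δ j
ConnAtLeast∞-fin conn k k<j = conn k (fin≤fin k<j)

ConnAtLeast-suc : ∀ {n} {Δ : Complex n} {j} → ConnAtLeast Δ j → HVanish Δ j → ConnAtLeast Δ (suc j)
ConnAtLeast-suc {j = j} conn H̃ⱼ k k<j+1 with k ℕ.<? j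
... | yes k<j = conn k k<j
... | no  k≮j = subst (HVanish _) (sym (ℕₚ.≤∧≮⇒≡ (ℕₚ.≤-pred k<j+1) k≮j)) H̃ⱼ

ConnH⇒≥ : ∀ {n} {Δ : Complex n} {x m} → ConnH Δ x → ConnAtLeast Δ m → fin m ≤∞ x
ConnH⇒≥ {x = fin α} {m} (_ , ¬H̃α) connₘ with m ≤? α
... | yes m≤α = fin≤fin m≤α
... | no  m≰α = ⊥-elim (¬H̃α (connₘ α (ℕₚ.≰⇒> m≰α)))
ConnH⇒≥ {x = ∞} _ _ = ≤∞-top

ConnH-intro : ∀ {n} {Δ : Complex n} {x} → ConnAtLeast∞ Δ x → (∀ j → x ≡ fin j → ¬ HVanish Δ j) → ConnH Δ x
ConnH-intro {x = fin j} conn ub = ConnAtLeast∞-fin conn , ub j refl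
ConnH-intro {x = ∞}     conn _  = λ k → conn k ≤∞-top

maxList-conn : ∀ {n} {Δ : Complex n} xs → All (ConnAtLeast∞ Δ) xs → ConnAtLeast∞ Δ (maxList xs)
maxList-conn xs conns k k<max with ≤∞-maxList⁻ xs k<max
... | x , x∈xs , k<x = All.lookup conns x∈xs k k<x

-- Splitting a complex along a simplex F

record Splitting (n : ℕ) : Set₁ where
  field
    F              : Subset n
    Δ⁺ Δ L         : Complex n
    Δ⁺-downClosed  : ∀ τ v → lookup τ v ≡ false → Δ⁺ (τ ∪ ⁅ v ⁆) → Δ⁺ τ
    Δ⊆Δ⁺           : ∀ σ → Δ σ → Δ⁺ σ
    Δ-avoids-F     : ∀ σ → Δ σ → ¬ F ⊆ₗ σ
    Δ⁺-avoiding-F  : ∀ σ → Δ⁺ σ → ¬ F ⊆ₗ σ → Δ σ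
    L⇒Δ⁺           : ∀ τ → L τ → Δ⁺ (F ∪ τ)
    Δ⁺⇒L           : ∀ τ → Disjoint τ F → Δ⁺ (F ∪ τ) → L τ
    L-disjoint     : ∀ τ → L τ → Disjoint τ F

module SplittingHomology {n} (S : Splitting n) where
  open Splitting S
  open Join F

  -- The component of d on the faces containing F, viewed as a chain on L.
  linkPart : Chain n → Chain n
  linkPart d τ = if does (disjoint? τ F) then sgn (inversions τ) (d (F ∪ τ)) else 0ℤ

  linkPart-disjoint : ∀ d τ → Disjoint τ F → linkPart d τ ≡ sgn (inversions τ) (d (F ∪ τ))
  linkPart-disjoint d τ τ#F =
    cong (λ b → if b then sgn (inversions τ) (d (F ∪ τ)) else 0ℤ) (dec-true (disjoint? τ F) τ#F)

  linkPart-meeting : ∀ d τ → ¬ Disjoint τ F → linkPart d τ ≡ 0ℤ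
  linkPart-meeting d τ τ∦F =
    cong (λ b → if b then sgn (inversions τ) (d (F ∪ τ)) else 0ℤ) (dec-false (disjoint? τ F) τ∦F)

  join-linkPart : ∀ d σ → F ⊆ₗ σ → join (linkPart d) σ ≡ d σ
  join-linkPart d σ F⊆σ = begin
    join (linkPart d) σ                                   ≡⟨ join-⊇ (linkPart d) σ F⊆σ ⟩
    sgn (inversions τ) (linkPart d τ)                     ≡⟨ cong (sgn (inversions τ)) (linkPart-disjoint d τ (─-disjoint σ F)) ⟩
    sgn (inversions τ) (sgn (inversions τ) (d (F ∪ τ)))   ≡⟨ sgn-involutive (inversions τ) (d (F ∪ τ)) ⟩
    d (F ∪ τ)                                             ≡⟨ cong d (∪-─-cancel F σ F⊆σ) ⟩
    d σ                                                   ∎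
    where
    open ≡-Reasoning
    τ : Subset n
    τ = σ ─ F

  linkPart-supported : ∀ m d → SupportedOn Δ⁺ m d → SupportedOn L (m ∸ ∣ F ∣) (linkPart d)
  linkPart-supported m d d-supp τ τ∉Lₘ₋ with disjoint? τ F
  ... | no τ∦F = linkPart-meeting d τ τ∦F
  ... | yes τ#F = trans (linkPart-disjoint d τ τ#F)
                        (trans (cong (sgn (inversions τ)) (d-supp (F ∪ τ) F∪τ∉Δ⁺ₘ)) (sgn-0 (inversions τ)))
    where
    F∪τ∉Δ⁺ₘ : ¬ (Δ⁺ (F ∪ τ) × ∣ F ∪ τ ∣ ≡ m)
    F∪τ∉Δ⁺ₘ (F∪τ∈Δ⁺ , ∣F∪τ∣≡m) = τ∉Lₘ₋
      ( Δ⁺⇒L τ τ#F F∪τ∈Δ⁺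
      , trans (sym (ℕₚ.m+n∸m≡n ∣ F ∣ ∣ τ ∣)) (cong (_∸ ∣ F ∣) (trans (sym (∣∪∣ F τ (disjoint-sym τ F τ#F))) ∣F∪τ∣≡m)))

  linkPart-avoids : ∀ d → AvoidsF (linkPart d)
  linkPart-avoids d τ u u∈τ u∈F = linkPart-meeting d τ λ τ#F → true≢false (trans (sym (cong₂ _∧_ u∈τ u∈F)) (τ#F u))

  linkPart-cycle : ∀ d → (∀ σ → F ⊆ₗ σ → ∂ d σ ≡ 0ℤ) → ∀ τ → ∂ (linkPart d) τ ≡ 0ℤ
  linkPart-cycle d d-cycle τ with disjoint? τ F
  ... | yes τ#F = sgn≡0⇒≡0 (inversions τ) _ (begin
    sgn (inversions τ) (∂ (linkPart d) τ)       ≡⟨ cong (λ ρ → sgn (inversions ρ) (∂ (linkPart d) ρ)) (∪-─-cancelˡ F τ τ#F) ⟨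
    sgn (inversions (σ ─ F)) (∂ (linkPart d) (σ ─ F)) ≡⟨ ∂-join (linkPart d) (linkPart-avoids d) σ F⊆σ ⟨
    ∂ (join (linkPart d)) σ                     ≡⟨ ∂-cong-cofaces (join (linkPart d)) d σ join≡d ⟩
    ∂ d σ                                       ≡⟨ d-cycle σ F⊆σ ⟩
    0ℤ                                          ∎)
    where
    open ≡-Reasoning
    σ : Subset n
    σ = F ∪ τ
    F⊆σ : F ⊆ₗ σ
    F⊆σ = p⊆ₗp∪q F τ
    join≡d : ∀ v → lookup σ v ≡ false → join (linkPart d) (σ ∪ ⁅ v ⁆) ≡ d (σ ∪ ⁅ v ⁆)
    join≡d v _ = join-linkPart d (σ ∪ ⁅ v ⁆) (⊆ₗ-trans F σ (σ ∪ ⁅ v ⁆) F⊆σ (p⊆ₗp∪q σ ⁅ v ⁆))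
  ... | no τ∦F = ∂-vanishes (linkPart d) τ λ v _ → linkPart-meeting d (τ ∪ ⁅ v ⁆) λ τ∪v#F → τ∦F λ u →
    shrink u (τ∪v#F u)
    where
    shrink : ∀ {v} u → (lookup (τ ∪ ⁅ v ⁆) u ∧ lookup F u) ≡ false → (lookup τ u ∧ lookup F u) ≡ false
    shrink {v} u τ∪v#F rewrite lookup-∪ τ ⁅ v ⁆ u with lookup τ u
    ... | true  = τ∪v#F
    ... | false = refl

  L-supported-avoids : ∀ k f → SupportedOn L k f → AvoidsF f
  L-supported-avoids k f f-supp τ u u∈τ u∈F =
    f-supp τ λ (τ∈L , _) → true≢false (trans (sym (cong₂ _∧_ u∈τ u∈F)) (L-disjoint τ τ∈L u))

  join-supported : ∀ m f → ∣ F ∣ ≤ m → SupportedOn L (suc (m ∸ ∣ F ∣)) f → SupportedOn Δ⁺ (suc m) (join f)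
  join-supported m f ∣F∣≤m f-supp σ σ∉Δ⁺ₘ₊₁ with F ⊆ₗ? σ
  ... | no F⊈σ = join-⊉ f σ F⊈σ
  ... | yes F⊆σ = trans (join-⊇ f σ F⊆σ)
                        (trans (cong (sgn (inversions (σ ─ F))) (f-supp (σ ─ F) σ─F∉L)) (sgn-0 (inversions (σ ─ F))))
    where
    σ─F∉L : ¬ (L (σ ─ F) × ∣ σ ─ F ∣ ≡ suc (m ∸ ∣ F ∣))
    σ─F∉L (σ─F∈L , ∣σ─F∣≡) = σ∉Δ⁺ₘ₊₁
      ( subst Δ⁺ (∪-─-cancel F σ F⊆σ) (L⇒Δ⁺ (σ ─ F) σ─F∈L)
      , trans (∣∣≡∣F∣+∣─F∣ F σ F⊆σ)
          (trans (cong (∣ F ∣ ℕ.+_) ∣σ─F∣≡) (trans (ℕₚ.+-suc _ _) (cong suc (ℕₚ.m+[n∸m]≡n ∣F∣≤m)))))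

  -- On the faces containing F, chains of Δ⁺ are joins of chains of L, so H̃(L) shifted by |F| decides this.
  fill-star : ∀ m (d : Chain n) → SupportedOn Δ⁺ m d → (∀ σ → F ⊆ₗ σ → ∂ d σ ≡ 0ℤ) →
    (∣ F ∣ ≤ m → HVanish L (m ∸ ∣ F ∣)) →
    ∃ λ g → SupportedOn Δ⁺ (suc m) g × (∀ σ → F ⊆ₗ σ → d σ ≡ ∂ g σ)
  fill-star m d d-supp d-cycle L-acyclic with ∣ F ∣ ≤? m
  ... | no ∣F∣≰m = (λ _ → 0ℤ) , (λ _ _ → refl) , λ σ F⊆σ →
    let ∣F∣≤∣σ∣ = subst (∣ F ∣ ≤_) (sym (∣∣≡∣F∣+∣─F∣ F σ F⊆σ)) (ℕₚ.m≤m+n _ _)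
    in trans (d-supp σ λ (_ , ∣σ∣≡m) → ∣F∣≰m (subst (∣ F ∣ ≤_) ∣σ∣≡m ∣F∣≤∣σ∣))
             (sym (∂-vanishes (λ _ → 0ℤ) σ λ _ _ → refl))
  ... | yes ∣F∣≤m with L-acyclic ∣F∣≤m (linkPart d) (linkPart-supported m d d-supp) (linkPart-cycle d d-cycle)
  ...   | f , f-supp , ∂f≡ = join f , join-supported m f ∣F∣≤m f-supp , λ σ F⊆σ → sym (begin
    ∂ (join f) σ                                        ≡⟨ ∂-join f (L-supported-avoids _ f f-supp) σ F⊆σ ⟩
    sgn (inversions (σ ─ F)) (∂ f (σ ─ F))              ≡⟨ cong (sgn (inversions (σ ─ F))) (∂f≡ (σ ─ F)) ⟩
    sgn (inversions (σ ─ F)) (linkPart d (σ ─ F))       ≡⟨ join-⊇ (linkPart d) σ F⊆σ ⟨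
    join (linkPart d) σ                                 ≡⟨ join-linkPart d σ F⊆σ ⟩
    d σ                                                 ∎)
    where open ≡-Reasoning

  minus-∂-supported : ∀ k (c g : Chain n) → SupportedOn Δ⁺ k c → SupportedOn Δ⁺ (suc k) g →
    (∀ σ → F ⊆ₗ σ → c σ ≡ ∂ g σ) → SupportedOn Δ k (λ σ → c σ + - ∂ g σ)
  minus-∂-supported k c g c-supp g-supp c≡∂g σ σ∉Δₖ with F ⊆ₗ? σ
  ... | yes F⊆σ = trans (cong (_+ - ∂ g σ) (c≡∂g σ F⊆σ)) (ℤₚ.+-inverseʳ (∂ g σ))
  ... | no F⊈σ = cong₂ (λ a b → a + - b) (c-supp σ σ∉Δ⁺ₖ) (∂-supported Δ⁺ Δ⁺-downClosed k g g-supp σ σ∉Δ⁺ₖ)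
    where
    σ∉Δ⁺ₖ : ¬ (Δ⁺ σ × ∣ σ ∣ ≡ k)
    σ∉Δ⁺ₖ (σ∈Δ⁺ , ∣σ∣≡k) = σ∉Δₖ (Δ⁺-avoiding-F σ σ∈Δ⁺ F⊈σ , ∣σ∣≡k)

  Δ-supported⇒Δ⁺-supported : ∀ k c → SupportedOn Δ k c → SupportedOn Δ⁺ k c
  Δ-supported⇒Δ⁺-supported k c c-supp σ σ∉Δ⁺ₖ = c-supp σ λ (σ∈Δ , ∣σ∣≡k) → σ∉Δ⁺ₖ (Δ⊆Δ⁺ σ σ∈Δ , ∣σ∣≡k)

  -- Subtracting a filling on the faces containing F leaves a cycle of Δ.
  HVanish-Δ⁺ : ∀ k → HVanish Δ k → (∣ F ∣ ≤ k → HVanish L (k ∸ ∣ F ∣)) → HVanish Δ⁺ k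
  HVanish-Δ⁺ k Δ-acyclic L-acyclic c c-supp c-cycle
    with fill-star k c c-supp (λ σ _ → c-cycle σ) L-acyclic
  ... | g , g-supp , c≡∂g
    with Δ-acyclic (λ σ → c σ + - ∂ g σ) (minus-∂-supported k c g c-supp g-supp c≡∂g)
                   (λ τ → trans (∂-minus-boundary c g τ) (c-cycle τ))
  ... | h , h-supp , ∂h≡ = (λ σ → h σ + g σ) , h+g-supp , ∂h+g≡c
    where
    h+g-supp : SupportedOn Δ⁺ (suc k) (λ σ → h σ + g σ)
    h+g-supp σ σ∉Δ⁺ = cong₂ _+_ (Δ-supported⇒Δ⁺-supported (suc k) h h-supp σ σ∉Δ⁺) (g-supp σ σ∉Δ⁺)
    ∂h+g≡c : ∀ σ → ∂ (λ σ → h σ + g σ) σ ≡ c σ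
    ∂h+g≡c σ = begin
      ∂ (λ σ → h σ + g σ) σ      ≡⟨ ∂-+ h g σ ⟩
      ∂ h σ + ∂ g σ              ≡⟨ cong (_+ ∂ g σ) (∂h≡ σ) ⟩
      (c σ + - ∂ g σ) + ∂ g σ    ≡⟨ ℤₚ.+-assoc (c σ) (- ∂ g σ) (∂ g σ) ⟩
      c σ + (- ∂ g σ + ∂ g σ)    ≡⟨ cong (c σ +_) (ℤₚ.+-inverseˡ (∂ g σ)) ⟩
      c σ + 0ℤ                   ≡⟨ ℤₚ.+-identityʳ (c σ) ⟩
      c σ                        ∎
      where open ≡-Reasoning

  -- A filling in Δ⁺ is corrected on the faces containing F so that it lies in Δ.
  HVanish-Δ : ∀ k → HVanish Δ⁺ k → (∣ F ∣ ≤ suc k → HVanish L (suc k ∸ ∣ F ∣)) → HVanish Δ k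
  HVanish-Δ k Δ⁺-acyclic L-acyclic c c-supp c-cycle
    with Δ⁺-acyclic c (Δ-supported⇒Δ⁺-supported k c c-supp) c-cycle
  ... | d , d-supp , ∂d≡c
    with fill-star (suc k) d d-supp (λ σ F⊆σ → trans (∂d≡c σ) (c-supp σ λ (σ∈Δ , _) → Δ-avoids-F σ σ∈Δ F⊆σ)) L-acyclic
  ... | g , g-supp , d≡∂g =
    (λ σ → d σ + - ∂ g σ) , minus-∂-supported (suc k) d g d-supp g-supp d≡∂g ,
    λ σ → trans (∂-minus-boundary d g σ) (∂d≡c σ)

  ConnAtLeast-Δ⁺ : ∀ m → ConnAtLeast Δ m → ConnAtLeast L (suc m ∸ ∣ F ∣) → ConnAtLeast Δ⁺ m
  ConnAtLeast-Δ⁺ m Δ-conn L-conn k k<m =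
    HVanish-Δ⁺ k (Δ-conn k k<m) (λ ∣F∣≤k → L-conn (k ∸ ∣ F ∣) (ℕₚ.∸-monoˡ-< (ℕₚ.m≤n⇒m≤1+n k<m) ∣F∣≤k))

  ConnAtLeast∞-Δ : 1 ≤ ∣ F ∣ → ∀ a b → ConnAtLeast∞ Δ⁺ a → ConnAtLeast∞ L b →
    ConnAtLeast∞ Δ (min∞ a (b +∞ (∣ F ∣ ∸ 1)))
  ConnAtLeast∞-Δ 1≤∣F∣ a b Δ⁺-conn L-conn k k<min =
    let k<a , k<b+∣F∣-1 = min∞⁻ a (b +∞ (∣ F ∣ ∸ 1)) k<min
    in HVanish-Δ k (Δ⁺-conn k k<a) (λ ∣F∣≤k+1 → L-conn (suc k ∸ ∣ F ∣) (+∞-shift⁻ b 1≤∣F∣ ∣F∣≤k+1 k<b+∣F∣-1))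

⌊⌋≡true⇒ : ∀ {P : Set} (d : Dec P) → ⌊ d ⌋ ≡ true → P
⌊⌋≡true⇒ (yes p) _ = p

⌊⌋≡false⇒¬ : ∀ {P : Set} (d : Dec P) → ⌊ d ⌋ ≡ false → ¬ P
⌊⌋≡false⇒¬ (no ¬p) _ = ¬p

⌊⌋-true : ∀ {P : Set} (d : Dec P) → P → ⌊ d ⌋ ≡ true
⌊⌋-true d p = trans (isYes≗does d) (dec-true d p)

⌊⌋-false : ∀ {P : Set} (d : Dec P) → ¬ P → ⌊ d ⌋ ≡ false
⌊⌋-false d ¬p = trans (isYes≗does d) (dec-false d ¬p)

∈⇒1≤∣∣ : ∀ {n} (X : Subset n) u → lookup X u ≡ true → 1 ≤ ∣ X ∣
∈⇒1≤∣∣ X u u∈X = subst (_≤ ∣ X ∣) (∣⁅x⁆∣≡1 u) (p⊆q⇒∣p∣≤∣q∣ (⊆ₗ⇒⊆ {A = ⁅ u ⁆} {B = X} ⁅u⁆⊆X))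
  where
  ⁅u⁆⊆X : ⁅ u ⁆ ⊆ₗ X
  ⁅u⁆⊆X w w∈⁅u⁆ with w Finₚ.≟ u
  ... | yes refl = u∈X
  ... | no w≢u   = ⊥-elim (true≢false (trans (sym w∈⁅u⁆) (lookup-⁅⁆-other u w w≢u)))

∣∣≡1⇒unique : ∀ {n} (X : Subset n) u w → ∣ X ∣ ≡ 1 → lookup X u ≡ true → lookup X w ≡ true → u ≡ w
∣∣≡1⇒unique X u w ∣X∣≡1 u∈X w∈X with u Finₚ.≟ w
... | yes u≡w = u≡w
... | no u≢w  = ⊥-elim (ℕₚ.<-irrefl refl (begin-strict
    1              ≤⟨ ∈⇒1≤∣∣ (X ─ ⁅ u ⁆) w w∈X─u ⟩
    ∣ X ─ ⁅ u ⁆ ∣  <⟨ x∈p⇒∣p-x∣<∣p∣ (lookup⇒[]= u X u∈X) ⟩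
    ∣ X ∣          ≡⟨ ∣X∣≡1 ⟩
    1              ∎))
  where
  open ℕₚ.≤-Reasoning
  w∈X─u : lookup (X ─ ⁅ u ⁆) w ≡ true
  w∈X─u = trans (lookup-─ X ⁅ u ⁆ w) (cong₂ (λ a b → a ∧ not b) w∈X (lookup-⁅⁆-other u w (u≢w ∘ sym)))

⊂ₗ⇒∣∣< : ∀ {n} (Y X : Subset n) → Y ⊆ₗ X → Y ≢ X → ∣ Y ∣ < ∣ X ∣
⊂ₗ⇒∣∣< Y X Y⊆X Y≢X with ⊈ₗ⇒witness {A = X} {B = Y} (Y≢X ∘ ⊆ₗ-antisym Y X Y⊆X)
... | u , u∈X , u∉Y =
  p⊂q⇒∣p∣<∣q∣ (⊆ₗ⇒⊆ {A = Y} {B = X} Y⊆X , u , lookup⇒[]= u X u∈X ,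
               λ u∈Y → true≢false (trans (sym ([]=⇒lookup u∈Y)) u∉Y))

∈-⋃⁻ : ∀ {n} (xs : List (Subset n)) u → lookup (foldr _∪_ ⊥ xs) u ≡ true →
  ∃ λ X → X ∈ xs × lookup X u ≡ true
∈-⋃⁻ []       u u∈⋃ = ⊥-elim (true≢false (trans (sym u∈⋃) (lookup-⊥ u)))
∈-⋃⁻ (X ∷ xs) u u∈⋃ with lookup X u in u∈X
... | true  = X , here refl , u∈X
... | false with ∈-⋃⁻ xs u (trans (sym (cong (_∨ _) u∈X)) (trans (sym (lookup-∪ X _ u)) u∈⋃))
...   | Y , Y∈xs , u∈Y = Y , there Y∈xs , u∈Y

⊆-⋃ : ∀ {n} (xs : List (Subset n)) X → X ∈ xs → X ⊆ₗ foldr _∪_ ⊥ xs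
⊆-⋃ (Y ∷ xs) X (here refl)  = p⊆ₗp∪q Y (foldr _∪_ ⊥ xs)
⊆-⋃ (Y ∷ xs) X (there X∈xs) = ⊆ₗ-trans X (foldr _∪_ ⊥ xs) (Y ∪ foldr _∪_ ⊥ xs) (⊆-⋃ xs X X∈xs) (q⊆ₗp∪q Y (foldr _∪_ ⊥ xs))

any-foldr⁻ : ∀ {A : Set} (p : A → Bool) (xs : List A) → foldr (λ Y b → p Y ∨ b) false xs ≡ true →
  ∃ λ Y → Y ∈ xs × p Y ≡ true
any-foldr⁻ p (Y ∷ xs) eq with p Y in pY
... | true  = Y , here refl , pY
... | false with any-foldr⁻ p xs eq
...   | Z , Z∈xs , pZ = Z , there Z∈xs , pZ

any-foldr⁺ : ∀ {A : Set} (p : A → Bool) (xs : List A) Y → Y ∈ xs → p Y ≡ true →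
  foldr (λ Y b → p Y ∨ b) false xs ≡ true
any-foldr⁺ p (Z ∷ xs) Y (here refl)  pY rewrite pY = refl
any-foldr⁺ p (Z ∷ xs) Y (there Y∈xs) pY rewrite any-foldr⁺ p xs Y Y∈xs pY = Boolₚ.∨-zeroʳ (p Z)

AllPairs-lookup : ∀ {A : Set} {R : A → A → Set} {xs : List A} → AllPairs R xs →
  ∀ {x y} → x ∈ xs → y ∈ xs → x ≢ y → R x y ⊎ R y x
AllPairs-lookup (_ ∷ _)     (here refl) (here refl) x≢y = ⊥-elim (x≢y refl)
AllPairs-lookup (Rx ∷ _)    (here refl) (there y∈) _    = inj₁ (All.lookup Rx y∈)
AllPairs-lookup (Ry ∷ _)    (there x∈)  (here refl) _   = inj₂ (All.lookup Ry x∈)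
AllPairs-lookup (_ ∷ pairs) (there x∈)  (there y∈) x≢y  = AllPairs-lookup pairs x∈ y∈ x≢y

AllPairs-tabulate : ∀ {A : Set} {R : A → A → Set} (xs : List A) → AllPairs _≢_ xs →
  (∀ {x y} → x ∈ xs → y ∈ xs → x ≢ y → R x y) → AllPairs R xs
AllPairs-tabulate []       _            _ = []
AllPairs-tabulate (x ∷ xs) (x≢ ∷ xs≢) R-all =
  All.tabulate (λ y∈ → R-all (here refl) (there y∈) (All.lookup x≢ y∈))
  ∷ AllPairs-tabulate xs xs≢ (λ x∈ y∈ → R-all (there x∈) (there y∈))

module Colon {n} (C : Hypergraph n) (F : Subset n) where

  -- These unfold the local definitions of _∶ₕ_, so that edges (C ∶ₕ F) ≡ deduplicate _≟ₛ_ minimal holds by refl.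
  N : Subset n
  N = Nbhd C F

  disjointN : Subset n → Bool
  disjointN X = ⌊ (X ∩ N) ≟ₛ ⊥ ⌋

  differences : List (Subset n)
  differences = map (λ E → E ─ F) (edges (C -ₕ F))

  avoidingN : List (Subset n)
  avoidingN = filter (λ X → disjointN X Bool.≟ true) differences

  candidates : List (Subset n)
  candidates = filter (λ X → ⌊ 2 ≤? ∣ X ∣ ⌋ Bool.≟ true) avoidingN

  strictlyBelow : Subset n → Subset n → Bool
  strictlyBelow Y X = ⌊ Y ⊆? X ⌋ ∧ not ⌊ Y ≟ₛ X ⌋

  isMin : Subset n → Bool
  isMin X = not (foldr (λ Y b → strictlyBelow Y X ∨ b) false candidates)

  minimal : List (Subset n)
  minimal = filter (λ X → isMin X Bool.≟ true) candidates

  ∈-minus⁻ : ∀ {E} → E ∈ edges (C -ₕ F) → E ∈ edges C × E ≢ F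
  ∈-minus⁻ = ∈-filter⁻ (λ E → ¬? (E ≟ₛ F))

  ∈-minus⁺ : ∀ {E} → E ∈ edges C → E ≢ F → E ∈ edges (C -ₕ F)
  ∈-minus⁺ = ∈-filter⁺ (λ E → ¬? (E ≟ₛ F))

  disjointN⁻ : ∀ X → disjointN X ≡ true → ∀ u → lookup X u ≡ true → lookup N u ≡ false
  disjointN⁻ X X#N u u∈X = begin
    lookup N u               ≡⟨ cong (_∧ lookup N u) u∈X ⟨
    lookup X u ∧ lookup N u  ≡⟨ lookup-∩ X N u ⟨
    lookup (X ∩ N) u         ≡⟨ cong (λ Y → lookup Y u) (⌊⌋≡true⇒ ((X ∩ N) ≟ₛ ⊥) X#N) ⟩
    lookup ⊥ u               ≡⟨ lookup-⊥ u ⟩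
    false                    ∎
    where open ≡-Reasoning

  disjointN⁺ : ∀ X → (∀ u → lookup X u ≡ true → lookup N u ≡ false) → disjointN X ≡ true
  disjointN⁺ X X#N = ⌊⌋-true ((X ∩ N) ≟ₛ ⊥) (subset-ext pointwise)
    where
    pointwise : ∀ u → lookup (X ∩ N) u ≡ lookup ⊥ u
    pointwise u rewrite lookup-∩ X N u | lookup-⊥ u with lookup X u in u∈X
    ... | false = refl
    ... | true  = X#N u u∈X

  record Candidate (X : Subset n) : Set where
    field
      E        : Subset n
      E∈C      : E ∈ edges C
      E≢F      : E ≢ F
      X≡E─F    : X ≡ E ─ F
      X#N      : disjointN X ≡ true
      2≤∣X∣    : 2 ≤ ∣ X ∣

  candidate⁻ : ∀ {X} → X ∈ candidates → Candidate X
  candidate⁻ {X} X∈ with ∈-filter⁻ (λ X → ⌊ 2 ≤? ∣ X ∣ ⌋ Bool.≟ true) X∈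
  ... | X∈′ , big with ∈-filter⁻ (λ X → disjointN X Bool.≟ true) X∈′
  ...   | X∈″ , X#N with ∈-map⁻ (λ E → E ─ F) X∈″
  ...     | E , E∈C-F , X≡E─F = record
    { E = E ; E∈C = proj₁ (∈-minus⁻ E∈C-F) ; E≢F = proj₂ (∈-minus⁻ E∈C-F)
    ; X≡E─F = X≡E─F ; X#N = X#N ; 2≤∣X∣ = ⌊⌋≡true⇒ (2 ≤? ∣ X ∣) big }

  candidate⁺ : ∀ {E} → E ∈ edges C → E ≢ F → disjointN (E ─ F) ≡ true → 2 ≤ ∣ E ─ F ∣ → E ─ F ∈ candidates
  candidate⁺ {E} E∈C E≢F E─F#N big =
    ∈-filter⁺ (λ X → ⌊ 2 ≤? ∣ X ∣ ⌋ Bool.≟ true)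
      (∈-filter⁺ (λ X → disjointN X Bool.≟ true) (∈-map⁺ (λ E → E ─ F) (∈-minus⁺ E∈C E≢F)) E─F#N)
      (⌊⌋-true (2 ≤? ∣ E ─ F ∣) big)

  ∈N⁻ : ∀ u → lookup N u ≡ true → ∃ λ E → E ∈ edges C × ∣ E ─ F ∣ ≡ 1 × lookup (E ─ F) u ≡ true
  ∈N⁻ u u∈N with ∈-⋃⁻ _ u u∈N
  ... | X , X∈ , u∈X with ∈-filter⁻ (λ X → ∣ X ∣ ℕ.≟ 1) X∈
  ...   | X∈′ , ∣X∣≡1 with ∈-map⁻ (λ E → E ─ F) X∈′
  ...     | E , E∈C , refl = E , E∈C , ∣X∣≡1 , u∈X

  ⊆N : ∀ {E} → E ∈ edges C → ∣ E ─ F ∣ ≡ 1 → E ─ F ⊆ₗ N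
  ⊆N {E} E∈C ∣E─F∣≡1 = ⊆-⋃ _ (E ─ F) (∈-filter⁺ (λ X → ∣ X ∣ ℕ.≟ 1) (∈-map⁺ (λ E → E ─ F) E∈C) ∣E─F∣≡1)

  minimal⁻ : ∀ {Y} → Y ∈ minimal → Y ∈ candidates × isMin Y ≡ true
  minimal⁻ = ∈-filter⁻ (λ X → isMin X Bool.≟ true)

  minimal-incomparable : ∀ {Y Z} → Y ∈ minimal → Z ∈ minimal → Y ≢ Z → ¬ Y ⊆ₗ Z
  minimal-incomparable {Y} {Z} Y∈ Z∈ Y≢Z Y⊆Z = true≢false (begin
    true                                                      ≡⟨ any-foldr⁺ (λ W → strictlyBelow W Z) candidates Y
                                                                   (proj₁ (minimal⁻ Y∈)) Y<Z ⟨
    foldr (λ W b → strictlyBelow W Z ∨ b) false candidates    ≡⟨ Boolₚ.not-involutive _ ⟨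
    not (isMin Z)                                             ≡⟨ cong not (proj₂ (minimal⁻ Z∈)) ⟩
    false                                                     ∎)
    where
    open ≡-Reasoning
    Y<Z : strictlyBelow Y Z ≡ true
    Y<Z = cong₂ (λ a b → a ∧ not b) (⌊⌋-true (Y ⊆? Z) (⊆ₗ⇒⊆ {A = Y} {B = Z} Y⊆Z)) (⌊⌋-false (Y ≟ₛ Z) Y≢Z)

  strictlyBelow⇒ : ∀ Y X → strictlyBelow Y X ≡ true → Y ⊆ₗ X × Y ≢ X
  strictlyBelow⇒ Y X = go (Y ⊆? X) (Y ≟ₛ X)
    where
    go : (a : Dec (Y ⊆ X)) (b : Dec (Y ≡ X)) → (⌊ a ⌋ ∧ not ⌊ b ⌋) ≡ true → Y ⊆ₗ X × Y ≢ X
    go (yes Y⊆X) (no Y≢X) _ = ⊆⇒⊆ₗ Y⊆X , Y≢X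
    go (yes _)   (yes _)  ()
    go (no _)    _        ()

  minimal-below : ∀ X → X ∈ candidates → ∃ λ Y → Y ∈ minimal × Y ⊆ₗ X
  minimal-below X = go (suc ∣ X ∣) X (ℕₚ.n<1+n _)
    where
    go : ∀ bound X → ∣ X ∣ < bound → X ∈ candidates → ∃ λ Y → Y ∈ minimal × Y ⊆ₗ X
    go (suc bound) X ∣X∣<bound X∈ with isMin X in X-min
    ... | true  = X , ∈-filter⁺ (λ X → isMin X Bool.≟ true) X∈ X-min , λ _ u∈X → u∈X
    ... | false with any-foldr⁻ (λ W → strictlyBelow W X) candidates
                       (trans (sym (Boolₚ.not-involutive _)) (cong not X-min))
    ...   | Y , Y∈ , Y<X with strictlyBelow⇒ Y X Y<X
    ...     | Y⊆X , Y≢X with go bound Y (ℕₚ.<-≤-trans (⊂ₗ⇒∣∣< Y X Y⊆X Y≢X) (ℕₚ.≤-pred ∣X∣<bound)) Y∈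
    ...       | Z , Z∈ , Z⊆Y = Z , Z∈ , ⊆ₗ-trans Z Y X Z⊆Y Y⊆X

incomparable-edges : ∀ {n} (C : Hypergraph n) → IsHypergraph C →
  ∀ {E F} → E ∈ edges C → F ∈ edges C → E ≢ F → ¬ E ⊆ₗ F
incomparable-edges C (_ , _ , pairs) {E} {F} E∈C F∈C E≢F E⊆F with AllPairs-lookup pairs E∈C F∈C E≢F
... | inj₁ (E⊈F , _) = E⊈F (⊆ₗ⇒⊆ {A = E} {B = F} E⊆F)
... | inj₂ (_ , E⊈F) = E⊈F (⊆ₗ⇒⊆ {A = E} {B = F} E⊆F)

Ind-downClosed : ∀ {n} (D : Hypergraph n) σ ρ → σ ⊆ₗ ρ → Ind D ρ → Ind D σ
Ind-downClosed D σ ρ σ⊆ρ (ρ⊆V , ρ-independent) =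
  ⊆ₗ⇒⊆ {A = σ} {B = V D} (⊆ₗ-trans σ ρ (V D) σ⊆ρ (⊆⇒⊆ₗ {A = ρ} {B = V D} ρ⊆V)) ,
  All.map shrink ρ-independent
  where
  shrink : ∀ {E} → ¬ E ⊆ ρ → ¬ E ⊆ σ
  shrink {E} E⊈ρ E⊆σ = E⊈ρ (⊆ₗ⇒⊆ {A = E} {B = ρ} (⊆ₗ-trans E σ ρ (⊆⇒⊆ₗ {A = E} {B = σ} E⊆σ) σ⊆ρ))

module EdgeSplitting {n} (C : Hypergraph n) (C-hyp : IsHypergraph C) {F : Subset n} (F∈C : F ∈ edges C) where
  open Colon C F

  ∈V:F⁻ : ∀ τ → τ ⊆ V C ─ (F ∪ N) → ∀ u → lookup τ u ≡ true →
    lookup (V C) u ≡ true × lookup F u ≡ false × lookup N u ≡ false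
  ∈V:F⁻ τ τ⊆ u u∈τ = unpack (trans (sym (lookup-─ (V C) (F ∪ N) u)) (⊆⇒⊆ₗ τ⊆ u u∈τ))
    where
    unpack : (lookup (V C) u ∧ not (lookup (F ∪ N) u)) ≡ true →
      lookup (V C) u ≡ true × lookup F u ≡ false × lookup N u ≡ false
    unpack eq rewrite lookup-∪ F N u with lookup (V C) u | lookup F u | lookup N u | eq
    ... | true | false | false | _ = refl , refl , refl

  ∈V:F⁺ : ∀ u → lookup (V C) u ≡ true → lookup F u ≡ false → lookup N u ≡ false →
    lookup (V C ─ (F ∪ N)) u ≡ true
  ∈V:F⁺ u u∈V u∉F u∉N rewrite lookup-─ (V C) (F ∪ N) u | lookup-∪ F N u | u∈V | u∉F | u∉N = refl

  E⊆V : ∀ {E} → E ∈ edges C → E ⊆ₗ V C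
  E⊆V E∈C = ⊆⇒⊆ₗ (All.lookup (proj₁ C-hyp) E∈C)

  ─F-⊆ : ∀ E τ → E ⊆ₗ F ∪ τ → E ─ F ⊆ₗ τ
  ─F-⊆ E τ E⊆F∪τ u u∈E─F =
    let u∈E , u∉F = ∈─⁻ E F u u∈E─F
    in trans (sym (trans (lookup-∪ F τ u) (cong (_∨ lookup τ u) u∉F))) (E⊆F∪τ u u∈E)

  ⊆-F∪ : ∀ E τ → E ─ F ⊆ₗ τ → E ⊆ₗ F ∪ τ
  ⊆-F∪ E τ E─F⊆τ u u∈E with lookup F u in u∈F
  ... | true  = p⊆ₗp∪q F τ u u∈F
  ... | false = q⊆ₗp∪q F τ u (E─F⊆τ u (∈─⁺ E F u u∈E u∈F))

  L-disjoint : ∀ τ → Ind (C ∶ₕ F) τ → Disjoint τ F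
  L-disjoint τ (τ⊆ , _) u with lookup τ u in u∈τ
  ... | false = refl
  ... | true  = proj₁ (proj₂ (∈V:F⁻ τ τ⊆ u u∈τ))

  -- If E ─ F is a singleton it lies in N, otherwise it contains a minimal candidate, an edge of C : F.
  edge⊈F∪face : ∀ τ → Ind (C ∶ₕ F) τ → ∀ {E} → E ∈ edges C → E ≢ F → ¬ E ⊆ₗ F ∪ τ
  edge⊈F∪face τ (τ⊆ , τ-independent) {E} E∈C E≢F E⊆F∪τ
    with ⊈ₗ⇒witness {A = E} {B = F} (incomparable-edges C C-hyp E∈C F∈C E≢F)
  ... | u₀ , u₀∈E , u₀∉F with ∣ E ─ F ∣ ℕ.≟ 1
  ...   | yes ∣E─F∣≡1 = true≢false (trans (sym (⊆N E∈C ∣E─F∣≡1 u₀ u₀∈E─F)) (proj₂ (proj₂ (∈V:F⁻ τ τ⊆ u₀ (E─F⊆τ u₀ u₀∈E─F)))))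
    where
    E─F⊆τ : E ─ F ⊆ₗ τ
    E─F⊆τ = ─F-⊆ E τ E⊆F∪τ
    u₀∈E─F : lookup (E ─ F) u₀ ≡ true
    u₀∈E─F = ∈─⁺ E F u₀ u₀∈E u₀∉F
  ...   | no ∣E─F∣≢1 =
    let Y , Y∈minimal , Y⊆E─F = minimal-below (E ─ F) E─F∈candidates
    in All.lookup τ-independent (∈-deduplicate⁺ _≟ₛ_ Y∈minimal)
                  (⊆ₗ⇒⊆ {A = Y} {B = τ} (⊆ₗ-trans Y (E ─ F) τ Y⊆E─F E─F⊆τ))
    where
    E─F⊆τ : E ─ F ⊆ₗ τ
    E─F⊆τ = ─F-⊆ E τ E⊆F∪τ
    u₀∈E─F : lookup (E ─ F) u₀ ≡ true
    u₀∈E─F = ∈─⁺ E F u₀ u₀∈E u₀∉F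
    2≤∣E─F∣ : 2 ≤ ∣ E ─ F ∣
    2≤∣E─F∣ = ℕₚ.≤∧≢⇒< (∈⇒1≤∣∣ (E ─ F) u₀ u₀∈E─F) (∣E─F∣≢1 ∘ sym)
    E─F∈candidates : E ─ F ∈ candidates
    E─F∈candidates = candidate⁺ E∈C E≢F
      (disjointN⁺ (E ─ F) (λ u u∈ → proj₂ (proj₂ (∈V:F⁻ τ τ⊆ u (E─F⊆τ u u∈))))) 2≤∣E─F∣

  L⇒Δ⁺ : ∀ τ → Ind (C ∶ₕ F) τ → Ind (C -ₕ F) (F ∪ τ)
  L⇒Δ⁺ τ τ∈L@(τ⊆ , _) = ⊆ₗ⇒⊆ {A = F ∪ τ} {B = V C} F∪τ⊆V , All.tabulate independent
    where
    F∪τ⊆V : F ∪ τ ⊆ₗ V C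
    F∪τ⊆V u u∈F∪τ with lookup F u in u∈F
    ... | true  = E⊆V F∈C u u∈F
    ... | false = proj₁ (∈V:F⁻ τ τ⊆ u (trans (sym (cong (_∨ lookup τ u) u∈F)) (trans (sym (lookup-∪ F τ u)) u∈F∪τ)))
    independent : ∀ {E} → E ∈ edges (C -ₕ F) → ¬ E ⊆ F ∪ τ
    independent {E} E∈C-F E⊆F∪τ =
      edge⊈F∪face τ τ∈L (proj₁ (∈-minus⁻ E∈C-F)) (proj₂ (∈-minus⁻ E∈C-F)) (⊆⇒⊆ₗ {A = E} {B = F ∪ τ} E⊆F∪τ)

  Δ⁺⇒L : ∀ τ → Disjoint τ F → Ind (C -ₕ F) (F ∪ τ) → Ind (C ∶ₕ F) τ
  Δ⁺⇒L τ τ#F (F∪τ⊆V , F∪τ-independent) =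
    ⊆ₗ⇒⊆ {A = τ} {B = V C ─ (F ∪ N)} τ⊆V:F , All.tabulate independent
    where
    edge⊈F∪τ : ∀ {E} → E ∈ edges C → E ≢ F → ¬ E ⊆ₗ F ∪ τ
    edge⊈F∪τ {E} E∈C E≢F E⊆F∪τ = All.lookup F∪τ-independent (∈-minus⁺ E∈C E≢F) (⊆ₗ⇒⊆ {A = E} {B = F ∪ τ} E⊆F∪τ)
    -- A vertex u ∈ τ ∩ N would make E ⊆ F ∪ τ for the edge E with E ─ F = {u}.
    u∉N : ∀ u → lookup τ u ≡ true → lookup N u ≡ false
    u∉N u u∈τ with lookup N u in u∈N
    ... | false = refl
    ... | true with ∈N⁻ u u∈N
    ...   | E , E∈C , ∣E─F∣≡1 , u∈E─F = ⊥-elim (edge⊈F∪τ E∈C E≢F E⊆F∪τ)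
      where
      u∉F : lookup F u ≡ false
      u∉F = Boolₚ.¬-not λ u∈F → true≢false (trans (sym (cong₂ _∧_ u∈τ u∈F)) (τ#F u))
      E≢F : E ≢ F
      E≢F refl = true≢false (trans (sym u∈E─F) (trans (lookup-─ E E u) (cong (λ b → b ∧ not b) u∉F)))
      E⊆F∪τ : E ⊆ₗ F ∪ τ
      E⊆F∪τ = ⊆-F∪ E τ λ w w∈E─F → subst (λ x → lookup τ x ≡ true) (∣∣≡1⇒unique (E ─ F) u w ∣E─F∣≡1 u∈E─F w∈E─F) u∈τ
    τ⊆V:F : τ ⊆ₗ V C ─ (F ∪ N)
    τ⊆V:F u u∈τ = ∈V:F⁺ u (⊆⇒⊆ₗ {A = F ∪ τ} {B = V C} F∪τ⊆V u (q⊆ₗp∪q F τ u u∈τ))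
                    (Boolₚ.¬-not λ u∈F → true≢false (trans (sym (cong₂ _∧_ u∈τ u∈F)) (τ#F u))) (u∉N u u∈τ)
    independent : ∀ {Y} → Y ∈ edges (C ∶ₕ F) → ¬ Y ⊆ τ
    independent {Y} Y∈C:F Y⊆τ =
      let open Candidate (candidate⁻ (proj₁ (minimal⁻ (∈-deduplicate⁻ _≟ₛ_ minimal Y∈C:F))))
      in edge⊈F∪τ E∈C E≢F (⊆-F∪ E τ (subst (_⊆ₗ τ) X≡E─F (⊆⇒⊆ₗ {A = Y} {B = τ} Y⊆τ)))

  Δ⁺-avoiding-F : ∀ σ → Ind (C -ₕ F) σ → ¬ F ⊆ₗ σ → Ind C σ
  Δ⁺-avoiding-F σ (σ⊆V , σ-independent) F⊈σ = σ⊆V , All.tabulate independent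
    where
    independent : ∀ {E} → E ∈ edges C → ¬ E ⊆ σ
    independent {E} E∈C E⊆σ with E ≟ₛ F
    ... | yes refl = F⊈σ (⊆⇒⊆ₗ {A = E} {B = σ} E⊆σ)
    ... | no E≢F   = All.lookup σ-independent (∈-minus⁺ E∈C E≢F) E⊆σ

  1≤∣F∣ : 1 ≤ ∣ F ∣
  1≤∣F∣ = ℕₚ.≤-trans (s≤s z≤n) (All.lookup (proj₁ (proj₂ C-hyp)) F∈C)

  splitting : Splitting n
  splitting = record
    { F             = F
    ; Δ⁺            = Ind (C -ₕ F)
    ; Δ             = Ind C
    ; L             = Ind (C ∶ₕ F)
    ; Δ⁺-downClosed = λ τ v _ → Ind-downClosed (C -ₕ F) τ (τ ∪ ⁅ v ⁆) (p⊆ₗp∪q τ ⁅ v ⁆)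
    ; Δ⊆Δ⁺          = λ σ (σ⊆V , σ-independent) → σ⊆V , AllP.filter⁺ (λ E → ¬? (E ≟ₛ F)) σ-independent
    ; Δ-avoids-F    = λ σ (_ , σ-independent) F⊆σ → All.lookup σ-independent F∈C (⊆ₗ⇒⊆ {A = F} {B = σ} F⊆σ)
    ; Δ⁺-avoiding-F = Δ⁺-avoiding-F
    ; L⇒Δ⁺          = L⇒Δ⁺
    ; Δ⁺⇒L          = Δ⁺⇒L
    ; L-disjoint    = L-disjoint
    }

  isHypergraph-minus : IsHypergraph (C -ₕ F)
  isHypergraph-minus =
    let E⊆V , 2≤∣E∣ , incomparable = C-hyp
    in AllP.filter⁺ (λ E → ¬? (E ≟ₛ F)) E⊆V , AllP.filter⁺ (λ E → ¬? (E ≟ₛ F)) 2≤∣E∣ ,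
       AllPairsP.filter⁺ (λ E → ¬? (E ≟ₛ F)) incomparable

  isHypergraph-colon : IsHypergraph (C ∶ₕ F)
  isHypergraph-colon =
    All.tabulate (λ {Y} Y∈ → ⊆ₗ⇒⊆ {A = Y} {B = V C ─ (F ∪ N)} (candidate⊆V:F Y (candidate Y∈))) ,
    All.tabulate (λ Y∈ → Candidate.2≤∣X∣ (candidate⁻ (candidate Y∈))) ,
    AllPairs-tabulate (deduplicate _≟ₛ_ minimal) (Unique.deduplicate-! _≟ₛ_ minimal) incomparable
    where
    candidate : ∀ {Y} → Y ∈ edges (C ∶ₕ F) → Y ∈ candidates
    candidate Y∈ = proj₁ (minimal⁻ (∈-deduplicate⁻ _≟ₛ_ minimal Y∈))
    candidate⊆V:F : ∀ Y → Y ∈ candidates → Y ⊆ₗ V C ─ (F ∪ N)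
    candidate⊆V:F Y Y∈ u u∈Y =
      let open Candidate (candidate⁻ Y∈)
          u∈E , u∉F = ∈─⁻ E F u (subst (λ X → lookup X u ≡ true) X≡E─F u∈Y)
      in ∈V:F⁺ u (E⊆V E∈C u u∈E) u∉F (disjointN⁻ Y X#N u u∈Y)
    incomparable : ∀ {Y Z} → Y ∈ deduplicate _≟ₛ_ minimal → Z ∈ deduplicate _≟ₛ_ minimal → Y ≢ Z → Incomparable Y Z
    incomparable {Y} {Z} Y∈ Z∈ Y≢Z =
      (λ Y⊆Z → minimal-incomparable Y∈minimal Z∈minimal Y≢Z (⊆⇒⊆ₗ {A = Y} {B = Z} Y⊆Z)) ,
      (λ Z⊆Y → minimal-incomparable Z∈minimal Y∈minimal (Y≢Z ∘ sym) (⊆⇒⊆ₗ {A = Z} {B = Y} Z⊆Y))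
      where
      Y∈minimal : Y ∈ minimal
      Y∈minimal = ∈-deduplicate⁻ _≟ₛ_ minimal Y∈
      Z∈minimal : Z ∈ minimal
      Z∈minimal = ∈-deduplicate⁻ _≟ₛ_ minimal Z∈

edges-minus< : ∀ {n} (C : Hypergraph n) {F} → F ∈ edges C → length (edges (C -ₕ F)) < length (edges C)
edges-minus< C {F} F∈C = Listₚ.filter-notAll (λ E → ¬? (E ≟ₛ F)) (edges C) (Any.map (λ E≡F E≢F → E≢F (sym E≡F)) F∈C)

edges-colon≤edges-minus : ∀ {n} (C : Hypergraph n) F → length (edges (C ∶ₕ F)) ≤ length (edges (C -ₕ F))
edges-colon≤edges-minus C F = begin
  length (deduplicate _≟ₛ_ minimal) ≤⟨ Listₚ.length-deduplicate _≟ₛ_ minimal ⟩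
  length minimal                    ≤⟨ Listₚ.length-filter (λ X → isMin X Bool.≟ true) candidates ⟩
  length candidates                 ≤⟨ Listₚ.length-filter (λ X → ⌊ 2 ≤? ∣ X ∣ ⌋ Bool.≟ true) avoidingN ⟩
  length avoidingN                  ≤⟨ Listₚ.length-filter (λ X → disjointN X Bool.≟ true) differences ⟩
  length differences                ≡⟨ Listₚ.length-map (λ E → E ─ F) (edges (C -ₕ F)) ⟩
  length (edges (C -ₕ F))           ∎
  where
  open Colon C F
  open ℕₚ.≤-Reasoning

ψ-step : ∀ {n} → ℕ → Hypergraph n → Subset n → ℕ∞
ψ-step f C F = min∞ (ψ′ f (C -ₕ F)) (ψ′ f (C ∶ₕ F) +∞ (∣ F ∣ ∸ 1))

ψ′-noVertices : ∀ {n} f (C : Hypergraph n) → ⌊ V C ≟ₛ ⊥ ⌋ ≡ true → ψ′ f C ≡ fin 0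
ψ′-noVertices f C V≡⊥ rewrite V≡⊥ = refl

ψ′-noEdges : ∀ {n} f (U : Subset n) → ⌊ U ≟ₛ ⊥ ⌋ ≡ false → ψ′ f (hypergraph U []) ≡ ∞
ψ′-noEdges f U U≢⊥ rewrite U≢⊥ = refl

ψ′-edges : ∀ {n} f (U : Subset n) E Es → ⌊ U ≟ₛ ⊥ ⌋ ≡ false →
  ψ′ (suc f) (hypergraph U (E ∷ Es)) ≡ maxList (map (ψ-step f (hypergraph U (E ∷ Es))) (E ∷ Es))
ψ′-edges {n} f U E Es U≢⊥ = unfold (ψ′ f) (λ _ → refl)
  where
  -- Abstracting over ψ′ f keeps the rewrite from also touching the recursive calls.
  C : Hypergraph n
  C = hypergraph U (E ∷ Es)
  unfold : (h : Hypergraph n → ℕ∞) → (∀ D → ψ′ f D ≡ h D) →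
    ψ′ (suc f) C ≡ maxList (map (λ F → min∞ (h (C -ₕ F)) (h (C ∶ₕ F) +∞ (∣ F ∣ ∸ 1))) (E ∷ Es))
  unfold h ψ′≡h rewrite U≢⊥ =
    cong maxList (Listₚ.map-cong (λ F → cong₂ (λ a b → min∞ a (b +∞ (∣ F ∣ ∸ 1))) (ψ′≡h _) (ψ′≡h _)) (E ∷ Es))

data Shape {n} : Hypergraph n → Set where
  noVertices : ∀ {C} → ⌊ V C ≟ₛ ⊥ ⌋ ≡ true → Shape C
  noEdges    : ∀ {U} → ⌊ U ≟ₛ ⊥ ⌋ ≡ false → Shape (hypergraph U [])
  withEdges  : ∀ {U E Es} → ⌊ U ≟ₛ ⊥ ⌋ ≡ false → Shape (hypergraph U (E ∷ Es))

shape : ∀ {n} (C : Hypergraph n) → Shape C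
shape (hypergraph U Es) with ⌊ U ≟ₛ ⊥ ⌋ in U≟⊥ | Es
... | true  | _      = noVertices U≟⊥
... | false | []     = noEdges U≟⊥
... | false | _ ∷ _  = withEdges U≟⊥

edges-minus-fuel : ∀ {n} (C : Hypergraph n) {F} f → F ∈ edges C → length (edges C) ≤ suc f → length (edges (C -ₕ F)) ≤ f
edges-minus-fuel C f F∈C ∣C∣≤1+f = ℕₚ.≤-pred (ℕₚ.<-≤-trans (edges-minus< C F∈C) ∣C∣≤1+f)

edges-colon-fuel : ∀ {n} (C : Hypergraph n) {F} f → F ∈ edges C → length (edges C) ≤ suc f → length (edges (C ∶ₕ F)) ≤ f
edges-colon-fuel C {F} f F∈C ∣C∣≤1+f = ℕₚ.≤-trans (edges-colon≤edges-minus C F) (edges-minus-fuel C f F∈C ∣C∣≤1+f)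

ψ′-fuel : ∀ {n} f g (C : Hypergraph n) → length (edges C) ≤ f → length (edges C) ≤ g → ψ′ f C ≡ ψ′ g C
ψ′-fuel f g C ∣C∣≤f ∣C∣≤g with shape C
ψ′-fuel f g C _ _ | noVertices V≟⊥ = trans (ψ′-noVertices f C V≟⊥) (sym (ψ′-noVertices g C V≟⊥))
ψ′-fuel f g _ _ _ | noEdges {U} U≟⊥ = trans (ψ′-noEdges f U U≟⊥) (sym (ψ′-noEdges g U U≟⊥))
ψ′-fuel zero    g       _ () _ | withEdges _
ψ′-fuel (suc f) zero    _ _ () | withEdges _
ψ′-fuel (suc f) (suc g) (hypergraph U (E ∷ Es)) ∣C∣≤f ∣C∣≤g | withEdges U≟⊥ =
  trans (ψ′-edges f U E Es U≟⊥) (trans (cong maxList (Listₚ.map-cong-local (All.tabulate step≡)))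
                                        (sym (ψ′-edges g U E Es U≟⊥)))
  where
  C : Hypergraph _
  C = hypergraph U (E ∷ Es)
  step≡ : ∀ {F} → F ∈ E ∷ Es → ψ-step f C F ≡ ψ-step g C F
  step≡ {F} F∈C = cong₂ (λ a b → min∞ a (b +∞ (∣ F ∣ ∸ 1)))
    (ψ′-fuel f g (C -ₕ F) (edges-minus-fuel C f F∈C ∣C∣≤f) (edges-minus-fuel C g F∈C ∣C∣≤g))
    (ψ′-fuel f g (C ∶ₕ F) (edges-colon-fuel C f F∈C ∣C∣≤f) (edges-colon-fuel C g F∈C ∣C∣≤g))

ψ≡ψ′ : ∀ {n} f (C : Hypergraph n) → length (edges C) ≤ f → ψ C ≡ ψ′ f C
ψ≡ψ′ f C ∣C∣≤f = ψ′-fuel _ f C ℕₚ.≤-refl ∣C∣≤f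


-- The empty face is a cycle but no boundary.
¬HVanish₀-emptyFace : ∀ {n} (Δ : Complex n) → Δ ⊥ → (∀ σ → Δ σ → ∣ σ ∣ ≡ 0) → ¬ HVanish Δ 0
¬HVanish₀-emptyFace {n} Δ ∅∈Δ faces-empty H̃₋₁≡0 = 1ℤ≢0ℤ (begin
  1ℤ      ≡⟨ cong (λ b → if b then 1ℤ else 0ℤ) (⌊⌋-true (⊥ ≟ₛ ⊥) refl) ⟨
  c ⊥     ≡⟨ ∂d≡c ⊥ ⟨
  ∂ d ⊥   ≡⟨ ∂-vanishes d ⊥ (λ v _ → d-supported _ λ (σ∈Δ , ∣σ∣≡1) → 0≢1 (trans (sym (faces-empty _ σ∈Δ)) ∣σ∣≡1)) ⟩
  0ℤ      ∎)
  where
  open ≡-Reasoning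
  c : Chain n
  c σ = if ⌊ σ ≟ₛ ⊥ ⌋ then 1ℤ else 0ℤ
  c-supported : SupportedOn Δ 0 c
  c-supported σ σ∉Δ₀ with σ ≟ₛ ⊥
  ... | yes refl = ⊥-elim (σ∉Δ₀ (∅∈Δ , ∣⊥∣≡0 n))
  ... | no _     = refl
  c-cycle : ∀ τ → ∂ c τ ≡ 0ℤ
  c-cycle τ = ∂-vanishes c τ λ v _ → cong (λ b → if b then 1ℤ else 0ℤ) (⌊⌋-false ((τ ∪ ⁅ v ⁆) ≟ₛ ⊥) λ τ∪v≡⊥ →
    true≢false (trans (sym (lookup-∪⁅⁆-self τ v)) (trans (cong (λ σ → lookup σ v) τ∪v≡⊥) (lookup-⊥ v))))
  filling : ∃ λ d → SupportedOn Δ 1 d × (∀ σ → ∂ d σ ≡ c σ)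
  filling = H̃₋₁≡0 c c-supported c-cycle
  d : Chain n
  d = proj₁ filling
  d-supported : SupportedOn Δ 1 d
  d-supported = proj₁ (proj₂ filling)
  ∂d≡c : ∀ σ → ∂ d σ ≡ c σ
  ∂d≡c = proj₂ (proj₂ filling)
  1ℤ≢0ℤ : 1ℤ ≢ 0ℤ
  1ℤ≢0ℤ ()
  0≢1 : 0 ≢ 1
  0≢1 ()

Ind-noVertices : ∀ {n} (C : Hypergraph n) → IsHypergraph C → ⌊ V C ≟ₛ ⊥ ⌋ ≡ true → ¬ HVanish (Ind C) 0
Ind-noVertices {n} C (_ , 2≤∣E∣ , _) V≟⊥ = ¬HVanish₀-emptyFace (Ind C) ∅∈Ind faces-empty
  where
  V≡⊥ : V C ≡ ⊥
  V≡⊥ = ⌊⌋≡true⇒ (V C ≟ₛ ⊥) V≟⊥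
  ∣∣≡0 : ∀ σ → σ ⊆ V C → ∣ σ ∣ ≡ 0
  ∣∣≡0 σ σ⊆V = ℕₚ.n≤0⇒n≡0 (subst (∣ σ ∣ ≤_) (trans (cong ∣_∣ V≡⊥) (∣⊥∣≡0 n)) (p⊆q⇒∣p∣≤∣q∣ σ⊆V))
  ∅∈Ind : Ind C ⊥
  ∅∈Ind = subst (⊥ ⊆_) (sym V≡⊥) (λ u∈⊥ → u∈⊥) ,
          All.tabulate λ {E} E∈C E⊆⊥ → ℕₚ.≤⇒≯ (ℕₚ.≤-reflexive (∣∣≡0 E (subst (E ⊆_) (sym V≡⊥) E⊆⊥)))
                                               (ℕₚ.≤-trans (s≤s z≤n) (All.lookup 2≤∣E∣ E∈C))
  faces-empty : ∀ σ → Ind C σ → ∣ σ ∣ ≡ 0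
  faces-empty σ (σ⊆V , _) = ∣∣≡0 σ σ⊆V

-- The full simplex on a nonempty vertex set is a cone over any of its vertices.
Ind-noEdges-acyclic : ∀ {n} (U : Subset n) → ⌊ U ≟ₛ ⊥ ⌋ ≡ false → ∀ k → HVanish (Ind (hypergraph U [])) k
Ind-noEdges-acyclic U U≟⊥ with nonempty? U
... | no U-empty = ⊥-elim (⌊⌋≡false⇒¬ (U ≟ₛ ⊥) U≟⊥ (Empty-unique U-empty))
... | yes (v , v∈U) = cone-acyclic (Ind (hypergraph U [])) v cone
  where
  cone : ∀ τ → Ind (hypergraph U []) τ → Ind (hypergraph U []) (τ ∪ ⁅ v ⁆)
  cone τ (τ⊆U , []) = ⊆ₗ⇒⊆ {A = τ ∪ ⁅ v ⁆} {B = U} τ∪v⊆U , []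
    where
    τ∪v⊆U : τ ∪ ⁅ v ⁆ ⊆ₗ U
    τ∪v⊆U u u∈τ∪v with u Finₚ.≟ v
    ... | yes refl = []=⇒lookup v∈U
    ... | no u≢v   = ⊆⇒⊆ₗ {A = τ} {B = U} τ⊆U u (trans (sym (lookup-∪⁅⁆-other τ v u u≢v)) u∈τ∪v)

-- ψ versus connectivity

ConnAtLeast∞-ψ′ : ∀ {n} f (C : Hypergraph n) → IsHypergraph C → length (edges C) ≤ f → ConnAtLeast∞ (Ind C) (ψ′ f C)
ConnAtLeast∞-ψ′ f C C-hyp ∣C∣≤f with shape C
ConnAtLeast∞-ψ′ f C _ _ | noVertices V≟⊥ =
  subst (ConnAtLeast∞ (Ind C)) (sym (ψ′-noVertices f C V≟⊥)) λ _ → λ { (fin≤fin ()) }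
ConnAtLeast∞-ψ′ f _ _ _ | noEdges {U} U≟⊥ =
  subst (ConnAtLeast∞ (Ind (hypergraph U []))) (sym (ψ′-noEdges f U U≟⊥)) λ k _ → Ind-noEdges-acyclic U U≟⊥ k
ConnAtLeast∞-ψ′ zero    _ _ () | withEdges _
ConnAtLeast∞-ψ′ (suc f) (hypergraph U (E ∷ Es)) C-hyp ∣C∣≤f | withEdges U≟⊥ =
  subst (ConnAtLeast∞ (Ind C)) (sym (ψ′-edges f U E Es U≟⊥))
        (maxList-conn (map (ψ-step f C) (E ∷ Es)) (AllP.map⁺ (All.tabulate step-conn)))
  where
  C : Hypergraph _
  C = hypergraph U (E ∷ Es)
  step-conn : ∀ {F} → F ∈ E ∷ Es → ConnAtLeast∞ (Ind C) (ψ-step f C F)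
  step-conn {F} F∈C = SplittingHomology.ConnAtLeast∞-Δ splitting 1≤∣F∣ _ _
    (ConnAtLeast∞-ψ′ f (C -ₕ F) isHypergraph-minus (edges-minus-fuel C f F∈C ∣C∣≤f))
    (ConnAtLeast∞-ψ′ f (C ∶ₕ F) isHypergraph-colon (edges-colon-fuel C f F∈C ∣C∣≤f))
    where open EdgeSplitting C C-hyp F∈C

ConnAtLeast⇒≤ψ-step : ∀ {n} (C : Hypergraph n) → IsHypergraph C → ∀ {F} → F ∈ edges C → ∀ f j →
  (∀ j → ConnAtLeast (Ind C) j → ConnAtLeast (Ind (C ∶ₕ F)) (suc j ∸ ∣ F ∣)) →
  ConnH (Ind (C -ₕ F)) (ψ′ f (C -ₕ F)) → ConnH (Ind (C ∶ₕ F)) (ψ′ f (C ∶ₕ F)) →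
  ConnAtLeast (Ind C) j → fin j ≤∞ ψ-step f C F
ConnAtLeast⇒≤ψ-step C C-hyp {F} F∈C f j linkCondition C-F-conn C:F-conn C-conn =
  min∞-glb (ψ′ f (C -ₕ F)) (ψ′ f (C ∶ₕ F) +∞ (∣ F ∣ ∸ 1))
    (ConnH⇒≥ C-F-conn (SplittingHomology.ConnAtLeast-Δ⁺ splitting j C-conn L-conn))
    (+∞-shift⁺ (ψ′ f (C ∶ₕ F)) 1≤∣F∣ (ConnH⇒≥ C:F-conn L-conn))
  where
  open EdgeSplitting C C-hyp F∈C
  L-conn : ConnAtLeast (Ind (C ∶ₕ F)) (suc j ∸ ∣ F ∣)
  L-conn = linkCondition j C-conn

theorem3p16 : ∀ {n} (C : Hypergraph n) → IsHypergraph C → ProperlySplitted C →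
    ConnH (Ind C) (ψ C)
theorem3p16 C C-hyp C-split with shape C
theorem3p16 C C-hyp _ | noVertices V≟⊥ =
  subst (ConnH (Ind C)) (sym (ψ′-noVertices _ C V≟⊥)) ((λ _ ()) , Ind-noVertices C C-hyp V≟⊥)
theorem3p16 _ _ _ | noEdges {U} U≟⊥ =
  subst (ConnH (Ind (hypergraph U []))) (sym (ψ′-noEdges 0 U U≟⊥)) (Ind-noEdges-acyclic U U≟⊥)
theorem3p16 _ _ (noEdges ()) | withEdges _
theorem3p16 C@(hypergraph U (E ∷ Es)) C-hyp (split F F∈C linkCondition C-F-split C:F-split) | withEdges U≟⊥ =
  ConnH-intro C-conn λ j ψ≡j H̃ⱼ → fin-suc≰ (subst (fin (suc j) ≤∞_) ψ≡j (ψ-above j ψ≡j H̃ⱼ))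
  where
  open EdgeSplitting C C-hyp F∈C
  f : ℕ
  f = length Es
  C-conn : ConnAtLeast∞ (Ind C) (ψ C)
  C-conn = ConnAtLeast∞-ψ′ (suc f) C C-hyp ℕₚ.≤-refl
  C-F-conn : ConnH (Ind (C -ₕ F)) (ψ′ f (C -ₕ F))
  C-F-conn = subst (ConnH (Ind (C -ₕ F))) (ψ≡ψ′ f (C -ₕ F) (edges-minus-fuel C f F∈C ℕₚ.≤-refl))
                   (theorem3p16 (C -ₕ F) isHypergraph-minus C-F-split)
  C:F-conn : ConnH (Ind (C ∶ₕ F)) (ψ′ f (C ∶ₕ F))
  C:F-conn = subst (ConnH (Ind (C ∶ₕ F))) (ψ≡ψ′ f (C ∶ₕ F) (edges-colon-fuel C f F∈C ℕₚ.≤-refl))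
                   (theorem3p16 (C ∶ₕ F) isHypergraph-colon C:F-split)
  ψ-above : ∀ j → ψ C ≡ fin j → HVanish (Ind C) j → fin (suc j) ≤∞ ψ C
  ψ-above j ψ≡j H̃ⱼ = ≤∞-trans
    (ConnAtLeast⇒≤ψ-step C C-hyp F∈C f (suc j) linkCondition C-F-conn C:F-conn
      (ConnAtLeast-suc (ConnAtLeast∞-fin (subst (ConnAtLeast∞ (Ind C)) ψ≡j C-conn)) H̃ⱼ))
    (subst (ψ-step f C F ≤∞_) (sym (ψ′-edges f U E Es U≟⊥)) (≤∞-maxList (∈-map⁺ (ψ-step f C) F∈C)))
  fin-suc≰ : ∀ {j} → ¬ fin (suc j) ≤∞ fin j
  fin-suc≰ (fin≤fin j<j) = ℕₚ.<-irrefl refl j<j
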